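{- Let $a_5(n)$ be defined by $\sum_{n\ge0}a_5(n)q^n=\dfrac{(q^2;q^2)_\infty^4}{(q;q)_\infty^5}$. Then for every integer $n\ge0$, $$a_5(5n+3)\equiv0\pmod5.$$
   Context: For $|q|<1$, $(a;q)_\infty=\prod_{k\ge0}(1-aq^k)$. The number $a_5(n)$ counts partitions of $n$ in which even parts come in one color and odd parts may appear in one of five colors. -}

module Defs where

open import Data.Nat using (ℕ; zero; suc; _∸_)
open import Data.Nat.Divisibility using (_∣?_)
open import Data.Integer using (ℤ; +_; -_; _+_; _*_; 0ℤ; 1ℤ)
open import Relation.Nullary.Decidable using (⌊_⌋)
open import Data.Bool using (if_then_else_)

Series : Set
Series = ℕ → ℤ

sumTo : ℕ → (ℕ → ℤ) → ℤ
sumTo zero    f = f 0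
sumTo (suc n) f = sumTo n f + f (suc n)

_⊛_ : Series → Series → Series
(f ⊛ g) n = sumTo n (λ i → f i * g (n ∸ i))
infixl 7 _⊛_

one : Series
one zero    = 1ℤ
one (suc _) = 0ℤ

_^ₛ_ : Series → ℕ → Series
p ^ₛ zero  = one
p ^ₛ suc m = p ⊛ (p ^ₛ m)

-- The series 1 - q^k  (intended for k ≥ 1).
oneMinusQ^ : ℕ → Series
oneMinusQ^ k zero    = 1ℤ
oneMinusQ^ k (suc n) = if ⌊ suc n Data.Nat.≟ k ⌋ then - 1ℤ else 0ℤ

-- The series 1/(1 - q^k) = Σ_j q^{jk}  (for k ≥ 1): coefficient of q^n is 1 iff k ∣ n.
invOneMinusQ^ : ℕ → Series
invOneMinusQ^ k n = if ⌊ k ∣? n ⌋ then 1ℤ else 0ℤ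

prodTo : ℕ → (ℕ → Series) → Series
prodTo zero    F = one
prodTo (suc N) F = F (suc N) ⊛ prodTo N F

-- The factor (1 - q^{2k})^4 / (1 - q^k)^5 of (q^2;q^2)_∞^4 / (q;q)_∞^5.
factor : ℕ → Series
factor k = (oneMinusQ^ (2 Data.Nat.* k) ^ₛ 4) ⊛ (invOneMinusQ^ k ^ₛ 5)

-- a₅(n) = [q^n] (q^2;q^2)_∞^4 / (q;q)_∞^5.  Factors with k > n are ≡ 1 mod q^{n+1},
-- so the coefficient of q^n equals that of the finite product over 1 ≤ k ≤ n.
a₅ : ℕ → ℤ
a₅ n = prodTo n factor n

-- Modulo 5 we have (q;q)_∞^5 ≡ (q^5;q^5)_∞, so the generating function A of a₅ satisfies
-- A · (q^5;q^5)_∞ (q^10;q^10)_∞ ≡ (q^2;q^2)_∞^9 = ((q^2;q^2)_∞^3)^3.  By Jacobi's identity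
-- (q;q)_∞^3 = Σ_k (-1)^k (2k+1) q^{k(k+1)/2}, and a triangular number k(k+1)/2 is ≡ 0, 1 or 3
-- modulo 5, the last case occurring only when 5 ∣ 2k+1.  Hence (q^2;q^2)_∞^3 is, modulo 5,
-- supported on exponents ≡ 0, 2, its cube on exponents ≢ 3, and dividing by a series in q^5 with
-- constant term 1 does not change that: a₅(5n+3) ≡ 0.
-- Everything is done with finite products truncated at q^{N+1}.  Jacobi's identity (in x = q^s)
-- comes from the q-binomial theorem for Π_{-n ≤ j < n} (1 - z x^j): its value at z = 1 vanishes and
-- its derivative at z = 1 is -(x;x)_{n-1} (x;x)_n.  Multiplying by (x;x)_{n-1}, which cancels the
-- Gaussian binomials [2n, i]_x to high order, turns this into Σ_i i (-1)^{i+n} x^{(i-n)(i-n-1)/2}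
-- ≡ -(x;x)_∞^3, and pairing i with 2n+1-i gives Jacobi's form.

module Submission where

open import Defs
open import Data.Nat using (ℕ; NonZero)

module PowerSeries where

  open import Data.Nat as ℕ using (ℕ; zero; suc; _∸_; _≤_; _<_; z≤n; s≤s)
  import Data.Nat.Properties as ℕP
  open import Data.Integer as ℤ using (ℤ; -_; _+_; _*_; 0ℤ; 1ℤ)
  import Data.Integer.Properties as ℤP
  open import Data.Maybe using (Maybe; just; nothing)
  open import Data.Product using (_,_)
  open import Function using (_∘_)
  open import Relation.Binary.PropositionalEquality
  open import Relation.Nullary using (yes; no)
  open import Data.Empty using (⊥-elim)
  open import Algebra.Bundles using (CommutativeRing)
  open import Algebra.Properties.CommutativeSemigroup ℤP.+-commutativeSemigroup using (interchange)
  import Algebra.Solver.Ring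
  import Algebra.Solver.Ring.AlmostCommutativeRing as ACR
  import Relation.Binary.Reasoning.Setoid as SetoidReasoning

  sumTo-cong : ∀ n {f g : ℕ → ℤ} → (∀ i → i ≤ n → f i ≡ g i) → sumTo n f ≡ sumTo n g
  sumTo-cong zero    eq = eq 0 z≤n
  sumTo-cong (suc n) eq = cong₂ _+_ (sumTo-cong n (λ i i≤n → eq i (ℕP.m≤n⇒m≤1+n i≤n))) (eq (suc n) ℕP.≤-refl)

  sumTo-+ : ∀ n (f g : ℕ → ℤ) → sumTo n (λ i → f i + g i) ≡ sumTo n f + sumTo n g
  sumTo-+ zero    f g = refl
  sumTo-+ (suc n) f g = trans (cong (_+ (f (suc n) + g (suc n))) (sumTo-+ n f g))
    (interchange (sumTo n f) (sumTo n g) (f (suc n)) (g (suc n)))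

  sumTo-*ˡ : ∀ n c (f : ℕ → ℤ) → sumTo n (λ i → c * f i) ≡ c * sumTo n f
  sumTo-*ˡ zero    c f = refl
  sumTo-*ˡ (suc n) c f = trans (cong (_+ c * f (suc n)) (sumTo-*ˡ n c f)) (sym (ℤP.*-distribˡ-+ c (sumTo n f) (f (suc n))))

  sumTo-*ʳ : ∀ n c (f : ℕ → ℤ) → sumTo n (λ i → f i * c) ≡ sumTo n f * c
  sumTo-*ʳ zero    c f = refl
  sumTo-*ʳ (suc n) c f = trans (cong (_+ f (suc n) * c) (sumTo-*ʳ n c f)) (sym (ℤP.*-distribʳ-+ c (sumTo n f) (f (suc n))))

  sumTo-zero : ∀ n → sumTo n (λ _ → 0ℤ) ≡ 0ℤ
  sumTo-zero zero    = refl
  sumTo-zero (suc n) = cong (_+ 0ℤ) (sumTo-zero n)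

  sumTo-head : ∀ n (f : ℕ → ℤ) → sumTo (suc n) f ≡ f 0 + sumTo n (f ∘ suc)
  sumTo-head zero    f = refl
  sumTo-head (suc n) f = trans (cong (_+ f (suc (suc n))) (sumTo-head n f)) (ℤP.+-assoc (f 0) (sumTo n (f ∘ suc)) (f (suc (suc n))))

  sumTo-reverse : ∀ n (f : ℕ → ℤ) → sumTo n f ≡ sumTo n (λ i → f (n ∸ i))
  sumTo-reverse zero    f = refl
  sumTo-reverse (suc n) f = begin
      sumTo n f + f (suc n)
    ≡⟨ cong (_+ f (suc n)) (sumTo-reverse n f) ⟩
      sumTo n (λ i → f (n ∸ i)) + f (suc n)
    ≡⟨ ℤP.+-comm (sumTo n (λ i → f (n ∸ i))) (f (suc n)) ⟩
      f (suc n) + sumTo n (λ i → f (n ∸ i))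
    ≡⟨ sym (sumTo-head n (λ i → f (suc n ∸ i))) ⟩
      sumTo (suc n) (λ i → f (suc n ∸ i)) ∎
    where open ≡-Reasoning

  sumTo-triangle : ∀ n (F : ℕ → ℕ → ℤ) →
    sumTo n (λ i → sumTo i (λ k → F k i)) ≡ sumTo n (λ k → sumTo (n ∸ k) (λ l → F k (k ℕ.+ l)))
  sumTo-triangle zero    F = refl
  sumTo-triangle (suc n) F = begin
      sumTo n (λ i → sumTo i (λ k → F k i)) + (sumTo n (λ k → F k (suc n)) + F (suc n) (suc n))
    ≡⟨ cong (_+ (sumTo n (λ k → F k (suc n)) + F (suc n) (suc n))) (sumTo-triangle n F) ⟩
      rows n + (sumTo n (λ k → F k (suc n)) + F (suc n) (suc n))
    ≡⟨ sym (ℤP.+-assoc (rows n) (sumTo n (λ k → F k (suc n))) (F (suc n) (suc n))) ⟩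
      (rows n + sumTo n (λ k → F k (suc n))) + F (suc n) (suc n)
    ≡⟨ cong₂ _+_ (trans (sym (sumTo-+ n _ _)) (sumTo-cong n extendRow)) (cong (F (suc n)) (sym (ℕP.+-identityʳ (suc n)))) ⟩
      sumTo n (λ k → sumTo (suc n ∸ k) (λ l → F k (k ℕ.+ l))) + F (suc n) (suc n ℕ.+ 0)
    ≡⟨ cong (λ m → sumTo n (λ k → sumTo (suc n ∸ k) (λ l → F k (k ℕ.+ l))) + sumTo m (λ l → F (suc n) (suc n ℕ.+ l)))
            (sym (ℕP.n∸n≡0 (suc n))) ⟩
      sumTo (suc n) (λ k → sumTo (suc n ∸ k) (λ l → F k (k ℕ.+ l))) ∎
    where
    open ≡-Reasoning
    rows : ℕ → ℤ
    rows m = sumTo m (λ k → sumTo (m ∸ k) (λ l → F k (k ℕ.+ l)))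
    extendRow : ∀ k → k ≤ n →
      sumTo (n ∸ k) (λ l → F k (k ℕ.+ l)) + F k (suc n) ≡ sumTo (suc n ∸ k) (λ l → F k (k ℕ.+ l))
    extendRow k k≤n rewrite ℕP.+-∸-assoc 1 k≤n =
      cong (λ m → sumTo (n ∸ k) (λ l → F k (k ℕ.+ l)) + F k m)
        (trans (cong suc (sym (ℕP.m+[n∸m]≡n k≤n))) (sym (ℕP.+-suc k (n ∸ k))))

  sumBelow : ℕ → (ℕ → ℤ) → ℤ
  sumBelow zero    f = 0ℤ
  sumBelow (suc R) f = sumBelow R f + f R

  sumBelow-cong : ∀ R {f g : ℕ → ℤ} → (∀ i → i < R → f i ≡ g i) → sumBelow R f ≡ sumBelow R g
  sumBelow-cong zero    eq = refl
  sumBelow-cong (suc R) eq = cong₂ _+_ (sumBelow-cong R (λ i i<R → eq i (ℕP.m≤n⇒m≤1+n i<R))) (eq R ℕP.≤-refl)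

  sumBelow-+ : ∀ R (f g : ℕ → ℤ) → sumBelow R (λ i → f i + g i) ≡ sumBelow R f + sumBelow R g
  sumBelow-+ zero    f g = refl
  sumBelow-+ (suc R) f g = trans (cong (_+ (f R + g R)) (sumBelow-+ R f g)) (interchange (sumBelow R f) (sumBelow R g) (f R) (g R))

  sumBelow-head : ∀ R (f : ℕ → ℤ) → sumBelow (suc R) f ≡ f 0 + sumBelow R (f ∘ suc)
  sumBelow-head zero    f = trans (ℤP.+-identityˡ (f 0)) (sym (ℤP.+-identityʳ (f 0)))
  sumBelow-head (suc R) f = trans (cong (_+ f (suc R)) (sumBelow-head R f)) (ℤP.+-assoc (f 0) (sumBelow R (f ∘ suc)) (f (suc R)))

  sumBelow-reverse : ∀ R (f : ℕ → ℤ) → sumBelow R f ≡ sumBelow R (λ i → f (R ∸ suc i))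
  sumBelow-reverse zero    f = refl
  sumBelow-reverse (suc R) f =
    trans (cong (_+ f R) (sumBelow-reverse R f))
      (trans (ℤP.+-comm _ (f R)) (sym (sumBelow-head R (λ i → f (suc R ∸ suc i)))))

  -- A record rather than a bare Π-type, so that both sides can be inferred from a proof.
  infix 4 _≈_
  record _≈_ (f g : Series) : Set where
    constructor ext
    field app : ∀ n → f n ≡ g n
  open _≈_ public

  infixl 6 _+ₛ_ _-ₛ_
  _+ₛ_ : Series → Series → Series
  (f +ₛ g) n = f n + g n

  -ₛ_ : Series → Series
  (-ₛ f) n = - f n

  _-ₛ_ : Series → Series → Series
  f -ₛ g = f +ₛ (-ₛ g)

  0ₛ : Series
  0ₛ _ = 0ℤ

  ι : ℤ → Series
  ι c zero    = c
  ι c (suc _) = 0ℤ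

  -- The solver's unit; it agrees with  one  only up to  ≈.
  1ₛ : Series
  1ₛ = ι 1ℤ

  one≈1ₛ : one ≈ 1ₛ
  one≈1ₛ = ext λ { zero → refl ; (suc n) → refl }

  ≈-refl : ∀ {f} → f ≈ f
  ≈-refl = ext λ n → refl

  ≈-sym : ∀ {f g} → f ≈ g → g ≈ f
  ≈-sym p = ext λ n → sym (app p n)

  ≈-trans : ∀ {f g h} → f ≈ g → g ≈ h → f ≈ h
  ≈-trans p q = ext λ n → trans (app p n) (app q n)

  ι-⊛ : ∀ c f n → (ι c ⊛ f) n ≡ c * f n
  ι-⊛ c f zero    = refl
  ι-⊛ c f (suc n) = begin
      sumTo (suc n) (λ i → ι c i * f (suc n ∸ i))
    ≡⟨ sumTo-head n _ ⟩
      c * f (suc n) + sumTo n (λ i → 0ℤ * f (n ∸ i))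
    ≡⟨ cong (c * f (suc n) +_) (trans (sumTo-cong n (λ i _ → ℤP.*-zeroˡ (f (n ∸ i)))) (sumTo-zero n)) ⟩
      c * f (suc n) + 0ℤ
    ≡⟨ ℤP.+-identityʳ _ ⟩
      c * f (suc n) ∎
    where open ≡-Reasoning

  ⊛-cong : ∀ {f f′ g g′} → f ≈ f′ → g ≈ g′ → f ⊛ g ≈ f′ ⊛ g′
  ⊛-cong p q = ext λ n → sumTo-cong n (λ i _ → cong₂ _*_ (app p i) (app q (n ∸ i)))

  ⊛-comm : ∀ f g → f ⊛ g ≈ g ⊛ f
  ⊛-comm f g = ext λ n → trans (sumTo-reverse n _) (sumTo-cong n (λ i i≤n →
    trans (cong (λ j → f (n ∸ i) * g j) (ℕP.m∸[m∸n]≡n i≤n)) (ℤP.*-comm (f (n ∸ i)) (g i))))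

  1ₛ-⊛ : ∀ f → 1ₛ ⊛ f ≈ f
  1ₛ-⊛ f = ext λ n → trans (ι-⊛ 1ℤ f n) (ℤP.*-identityˡ (f n))

  ⊛-identityˡ : ∀ f → one ⊛ f ≈ f
  ⊛-identityˡ f = ≈-trans (⊛-cong one≈1ₛ (≈-refl {f})) (1ₛ-⊛ f)

  ⊛-identityʳ : ∀ f → f ⊛ one ≈ f
  ⊛-identityʳ f = ≈-trans (⊛-comm f one) (⊛-identityˡ f)

  ⊛-distribˡ : ∀ f g h → f ⊛ (g +ₛ h) ≈ (f ⊛ g) +ₛ (f ⊛ h)
  ⊛-distribˡ f g h = ext λ n →
    trans (sumTo-cong n (λ i _ → ℤP.*-distribˡ-+ (f i) (g (n ∸ i)) (h (n ∸ i)))) (sumTo-+ n _ _)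

  ⊛-distribʳ : ∀ f g h → (g +ₛ h) ⊛ f ≈ (g ⊛ f) +ₛ (h ⊛ f)
  ⊛-distribʳ f g h = ext λ n →
    trans (sumTo-cong n (λ i _ → ℤP.*-distribʳ-+ (f (n ∸ i)) (g i) (h i))) (sumTo-+ n _ _)

  ⊛-assoc : ∀ f g h → (f ⊛ g) ⊛ h ≈ f ⊛ (g ⊛ h)
  ⊛-assoc f g h = ext λ n → begin
      sumTo n (λ i → sumTo i (λ k → f k * g (i ∸ k)) * h (n ∸ i))
    ≡⟨ sumTo-cong n (λ i _ → sym (sumTo-*ʳ i (h (n ∸ i)) _)) ⟩
      sumTo n (λ i → sumTo i (λ k → f k * g (i ∸ k) * h (n ∸ i)))
    ≡⟨ sumTo-triangle n (λ k i → f k * g (i ∸ k) * h (n ∸ i)) ⟩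
      sumTo n (λ k → sumTo (n ∸ k) (λ l → f k * g (k ℕ.+ l ∸ k) * h (n ∸ (k ℕ.+ l))))
    ≡⟨ sumTo-cong n (λ k _ → trans (sumTo-cong (n ∸ k) (λ l _ →
          trans (cong₂ (λ a b → f k * g a * h b) (ℕP.m+n∸m≡n k l) (sym (ℕP.∸-+-assoc n k l)))
                (ℤP.*-assoc (f k) (g l) (h (n ∸ k ∸ l)))))
          (sumTo-*ˡ (n ∸ k) (f k) _)) ⟩
      sumTo n (λ k → f k * sumTo (n ∸ k) (λ l → g l * h (n ∸ k ∸ l))) ∎
    where open ≡-Reasoning

  series-commutativeRing : CommutativeRing _ _
  series-commutativeRing = record
    { Carrier = Series ; _≈_ = _≈_ ; _+_ = _+ₛ_ ; _*_ = _⊛_ ; -_ = -ₛ_ ; 0# = 0ₛ ; 1# = one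
    ; isCommutativeRing = record
      { isRing = record
        { +-isAbelianGroup = record
          { isGroup = record
            { isMonoid = record
              { isSemigroup = record
                { isMagma = record
                  { isEquivalence = record { refl = ≈-refl ; sym = ≈-sym ; trans = ≈-trans }
                  ; ∙-cong = λ p q → ext λ n → cong₂ _+_ (app p n) (app q n) }
                ; assoc = λ f g h → ext λ n → ℤP.+-assoc (f n) (g n) (h n) }
              ; identity = (λ f → ext λ n → ℤP.+-identityˡ (f n)) , (λ f → ext λ n → ℤP.+-identityʳ (f n)) }
            ; inverse = (λ f → ext λ n → ℤP.+-inverseˡ (f n)) , (λ f → ext λ n → ℤP.+-inverseʳ (f n))
            ; ⁻¹-cong = λ p → ext λ n → cong -_ (app p n) }
          ; comm = λ f g → ext λ n → ℤP.+-comm (f n) (g n) }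
        ; *-cong = ⊛-cong
        ; *-assoc = ⊛-assoc
        ; *-identity = ⊛-identityˡ , ⊛-identityʳ
        ; distrib = ⊛-distribˡ , ⊛-distribʳ }
      ; *-comm = ⊛-comm } }

  module ≈-Reasoning = SetoidReasoning (CommutativeRing.setoid series-commutativeRing)

  series-almostCommutativeRing : ACR.AlmostCommutativeRing _ _
  series-almostCommutativeRing = ACR.fromCommutativeRing series-commutativeRing

  ι-morphism : ℤ.+-*-rawRing ACR.-Raw-AlmostCommutative⟶ series-almostCommutativeRing
  ι-morphism = record
    { ⟦_⟧ = ι
    ; +-homo = λ a b → ext λ { zero → refl ; (suc n) → refl }
    ; *-homo = λ a b → ext λ n → sym (trans (ι-⊛ a (ι b) n) (ι-*ˡ a b n))
    ; -‿homo = λ a → ext λ { zero → refl ; (suc n) → refl }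
    ; 0-homo = ext λ { zero → refl ; (suc n) → refl }
    ; 1-homo = ext λ { zero → refl ; (suc n) → refl } }
    where
    ι-*ˡ : ∀ a b n → a * ι b n ≡ ι (a * b) n
    ι-*ˡ a b zero    = refl
    ι-*ˡ a b (suc n) = ℤP.*-zeroʳ a

  ι-≟ : ∀ a b → Maybe (ι a ≈ ι b)
  ι-≟ a b with a ℤ.≟ b
  ... | yes refl = just ≈-refl
  ... | no _     = nothing

  module SeriesSolver = Algebra.Solver.Ring ℤ.+-*-rawRing series-almostCommutativeRing ι-morphism ι-≟

  +ₛ-cong : ∀ {f f′ g g′} → f ≈ f′ → g ≈ g′ → f +ₛ g ≈ f′ +ₛ g′
  +ₛ-cong p q = ext λ n → cong₂ _+_ (app p n) (app q n)

  +ₛ-congˡ : ∀ f {g g′} → g ≈ g′ → f +ₛ g ≈ f +ₛ g′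
  +ₛ-congˡ f = +ₛ-cong (≈-refl {f})

  +ₛ-congʳ : ∀ {f f′} g → f ≈ f′ → f +ₛ g ≈ f′ +ₛ g
  +ₛ-congʳ g p = +ₛ-cong p (≈-refl {g})

  +ₛ-identityˡ : ∀ f → 0ₛ +ₛ f ≈ f
  +ₛ-identityˡ f = ext λ n → ℤP.+-identityˡ (f n)

  +ₛ-identityʳ : ∀ f → f +ₛ 0ₛ ≈ f
  +ₛ-identityʳ f = ext λ n → ℤP.+-identityʳ (f n)

  -ₛ-cong : ∀ {f f′} → f ≈ f′ → -ₛ f ≈ -ₛ f′
  -ₛ-cong p = ext λ n → cong -_ (app p n)

  ⊛-congʳ : ∀ {f f′} g → f ≈ f′ → f ⊛ g ≈ f′ ⊛ g
  ⊛-congʳ g p = ⊛-cong p (≈-refl {g})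

  ⊛-congˡ : ∀ f {g g′} → g ≈ g′ → f ⊛ g ≈ f ⊛ g′
  ⊛-congˡ f = ⊛-cong (≈-refl {f})

  ⊛-zeroʳ : ∀ f → f ⊛ 0ₛ ≈ 0ₛ
  ⊛-zeroʳ f = ext λ n → trans (sumTo-cong n (λ i _ → ℤP.*-zeroʳ (f i))) (sumTo-zero n)

  0ₛ≈ι0 : 0ₛ ≈ ι 0ℤ
  0ₛ≈ι0 = ext λ { zero → refl ; (suc n) → refl }

  ι-neg : ∀ a → ι (- a) ≈ -ₛ ι a
  ι-neg a = ext λ { zero → refl ; (suc n) → refl }

  shift : Series → Series
  shift f zero    = 0ℤ
  shift f (suc n) = f n

  shift-cong : ∀ {f g} → f ≈ g → shift f ≈ shift g
  shift-cong p = ext λ { zero → refl ; (suc n) → app p n }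

  shift-⊛ : ∀ f g → shift f ⊛ g ≈ shift (f ⊛ g)
  shift-⊛ f g = ext coeff
    where
    coeff : ∀ n → (shift f ⊛ g) n ≡ shift (f ⊛ g) n
    coeff zero    = ℤP.*-zeroˡ (g 0)
    coeff (suc n) = begin
        sumTo (suc n) (λ i → shift f i * g (suc n ∸ i))
      ≡⟨ sumTo-head n _ ⟩
        0ℤ * g (suc n) + (f ⊛ g) n
      ≡⟨ cong (_+ (f ⊛ g) n) (ℤP.*-zeroˡ (g (suc n))) ⟩
        0ℤ + (f ⊛ g) n
      ≡⟨ ℤP.+-identityˡ _ ⟩
        (f ⊛ g) n ∎
      where open ≡-Reasoning

  shiftBy : ℕ → Series → Series
  shiftBy zero    f = f
  shiftBy (suc e) f = shift (shiftBy e f)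

  shiftBy-< : ∀ e f d → d < e → shiftBy e f d ≡ 0ℤ
  shiftBy-< (suc e) f zero    _          = refl
  shiftBy-< (suc e) f (suc d) (s≤s d<e) = shiftBy-< e f d d<e

  shiftBy-+ : ∀ e f d → shiftBy e f (e ℕ.+ d) ≡ f d
  shiftBy-+ zero    f d = refl
  shiftBy-+ (suc e) f d = shiftBy-+ e f d

  q^_ : ℕ → Series
  q^ e = shiftBy e one

  q^-⊛ : ∀ e f → q^ e ⊛ f ≈ shiftBy e f
  q^-⊛ zero    f = ⊛-identityˡ f
  q^-⊛ (suc e) f = ≈-trans (shift-⊛ (q^ e) f) (shift-cong (q^-⊛ e f))

  q^-+ : ∀ a b → q^ a ⊛ q^ b ≈ q^ (a ℕ.+ b)
  q^-+ zero    b = ⊛-identityˡ (q^ b)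
  q^-+ (suc a) b = ≈-trans (shift-⊛ (q^ a) (q^ b)) (shift-cong (q^-+ a b))

  q^-≡ : ∀ {a b} → a ≡ b → q^ a ≈ q^ b
  q^-≡ refl = ≈-refl

  q^-diag : ∀ e → (q^ e) e ≡ 1ℤ
  q^-diag zero    = refl
  q^-diag (suc e) = q^-diag e

  q^-off : ∀ e d → d ≢ e → (q^ e) d ≡ 0ℤ
  q^-off zero    zero    d≢e = ⊥-elim (d≢e refl)
  q^-off zero    (suc d) d≢e = refl
  q^-off (suc e) zero    d≢e = refl
  q^-off (suc e) (suc d) d≢e = q^-off e d (d≢e ∘ cong suc)

  Σₛ : ℕ → (ℕ → Series) → Series
  Σₛ R F d = sumBelow R (λ i → F i d)

  -- The derivative at z = 1 of the polynomial  Σ_{i<R} F i z^i.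
  ∂Σₛ : ℕ → (ℕ → Series) → Series
  ∂Σₛ R F = Σₛ R (λ i → ι (ℤ.+ i) ⊛ F i)

  Σₛ-cong : ∀ R {F G} → (∀ i → i < R → F i ≈ G i) → Σₛ R F ≈ Σₛ R G
  Σₛ-cong R eq = ext λ d → sumBelow-cong R (λ i i<R → app (eq i i<R) d)

  Σₛ-+ : ∀ R F G → Σₛ R (λ i → F i +ₛ G i) ≈ Σₛ R F +ₛ Σₛ R G
  Σₛ-+ R F G = ext λ d → sumBelow-+ R (λ i → F i d) (λ i → G i d)

  ⊛-Σₛ : ∀ R c F → c ⊛ Σₛ R F ≈ Σₛ R (λ i → c ⊛ F i)
  ⊛-Σₛ zero    c F = ⊛-zeroʳ c
  ⊛-Σₛ (suc R) c F = ≈-trans (⊛-distribˡ c (Σₛ R F) (F R)) (+ₛ-congʳ (c ⊛ F R) (⊛-Σₛ R c F))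

  Σₛ-head : ∀ R F → Σₛ (suc R) F ≈ F 0 +ₛ Σₛ R (F ∘ suc)
  Σₛ-head R F = ext λ d → sumBelow-head R (λ i → F i d)

  Σₛ-pad : ∀ R k F → (∀ i → R ≤ i → F i ≈ 0ₛ) → Σₛ (k ℕ.+ R) F ≈ Σₛ R F
  Σₛ-pad R zero    F vanish = ≈-refl
  Σₛ-pad R (suc k) F vanish = ext λ d →
    trans (cong₂ _+_ (app (Σₛ-pad R k F vanish) d) (app (vanish (k ℕ.+ R) (ℕP.m≤n+m R k)) d)) (ℤP.+-identityʳ _)

  delay : (ℕ → Series) → ℕ → Series
  delay F zero    = 0ₛ
  delay F (suc i) = F i

  Σₛ-delay : ∀ R F → Σₛ (suc R) (delay F) ≈ Σₛ R F
  Σₛ-delay R F = ≈-trans (Σₛ-head R (delay F)) (+ₛ-identityˡ (Σₛ R F))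

  ∂Σₛ-pad : ∀ R k F → (∀ i → R ≤ i → F i ≈ 0ₛ) → ∂Σₛ (k ℕ.+ R) F ≈ ∂Σₛ R F
  ∂Σₛ-pad R k F vanish = Σₛ-pad R k (λ i → ι (ℤ.+ i) ⊛ F i)
    (λ i R≤i → ≈-trans (⊛-congˡ (ι (ℤ.+ i)) (vanish i R≤i)) (⊛-zeroʳ (ι (ℤ.+ i))))

  ∂Σₛ-delay : ∀ R F → ∂Σₛ (suc R) (delay F) ≈ ∂Σₛ R F +ₛ Σₛ R F
  ∂Σₛ-delay R F = begin
      Σₛ (suc R) (λ i → ι (ℤ.+ i) ⊛ delay F i)
    ≈⟨ Σₛ-head R _ ⟩
      ι (ℤ.+ 0) ⊛ 0ₛ +ₛ Σₛ R (λ i → ι (ℤ.+ suc i) ⊛ F i)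
    ≈⟨ +ₛ-cong (⊛-zeroʳ (ι (ℤ.+ 0))) (Σₛ-cong R (λ i _ → ι-suc-⊛ i)) ⟩
      0ₛ +ₛ Σₛ R (λ i → ι (ℤ.+ i) ⊛ F i +ₛ F i)
    ≈⟨ +ₛ-identityˡ _ ⟩
      Σₛ R (λ i → ι (ℤ.+ i) ⊛ F i +ₛ F i)
    ≈⟨ Σₛ-+ R _ _ ⟩
      ∂Σₛ R F +ₛ Σₛ R F ∎
    where
    open ≈-Reasoning
    ι-suc-⊛ : ∀ i → ι (ℤ.+ suc i) ⊛ F i ≈ ι (ℤ.+ i) ⊛ F i +ₛ F i
    ι-suc-⊛ i = ext λ d → trans (ι-⊛ (ℤ.+ suc i) (F i) d) (trans (cong (_* F i d) (ℤP.+-comm 1ℤ (ℤ.+ i)))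
      (trans (ℤP.*-distribʳ-+ (F i d) (ℤ.+ i) 1ℤ) (cong₂ _+_ (sym (ι-⊛ (ℤ.+ i) (F i) d)) (ℤP.*-identityˡ (F i d)))))

  Σₛ-linear₃ : ∀ R a b c F G H →
    Σₛ R (λ i → a ⊛ F i +ₛ b ⊛ G i +ₛ c ⊛ H i) ≈ a ⊛ Σₛ R F +ₛ b ⊛ Σₛ R G +ₛ c ⊛ Σₛ R H
  Σₛ-linear₃ R a b c F G H = begin
      Σₛ R (λ i → a ⊛ F i +ₛ b ⊛ G i +ₛ c ⊛ H i)
    ≈⟨ Σₛ-+ R (λ i → a ⊛ F i +ₛ b ⊛ G i) (λ i → c ⊛ H i) ⟩
      Σₛ R (λ i → a ⊛ F i +ₛ b ⊛ G i) +ₛ Σₛ R (λ i → c ⊛ H i)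
    ≈⟨ +ₛ-cong (Σₛ-+ R (λ i → a ⊛ F i) (λ i → b ⊛ G i)) (≈-sym (⊛-Σₛ R c H)) ⟩
      Σₛ R (λ i → a ⊛ F i) +ₛ Σₛ R (λ i → b ⊛ G i) +ₛ c ⊛ Σₛ R H
    ≈⟨ +ₛ-congʳ (c ⊛ Σₛ R H) (+ₛ-cong (≈-sym (⊛-Σₛ R a F)) (≈-sym (⊛-Σₛ R b G))) ⟩
      a ⊛ Σₛ R F +ₛ b ⊛ Σₛ R G +ₛ c ⊛ Σₛ R H ∎
    where open ≈-Reasoning

module Congruence5 where

  open PowerSeries
  open import Data.Nat as ℕ using (ℕ; zero; suc; _∸_; _≤_; _<_; z≤n; s≤s)
  import Data.Nat.Properties as ℕP
  open import Data.Integer using (ℤ; +_; -_; _+_; _*_; _-_; 0ℤ)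
  import Data.Integer.Properties as ℤP
  open import Data.Integer.Divisibility.Signed using (_∣_; divides; ∣m∣n⇒∣m+n; ∣m⇒∣-m; ∣n⇒∣m*n; ∣m⇒∣m*n)
  open import Data.Integer.Tactic.RingSolver using (solve-∀)
  open import Relation.Binary.PropositionalEquality

  infix 4 _≡₅_
  record _≡₅_ (a b : ℤ) : Set where
    constructor mod5
    field 5∣a-b : + 5 ∣ a - b
  open _≡₅_ public

  5∣0 : + 5 ∣ 0ℤ
  5∣0 = divides 0ℤ refl

  5∣5* : ∀ a → + 5 ∣ + 5 * a
  5∣5* a = divides a (ℤP.*-comm (+ 5) a)

  ≡⇒≡₅ : ∀ {a b} → a ≡ b → a ≡₅ b
  ≡⇒≡₅ {a} refl = mod5 (subst (+ 5 ∣_) (sym (ℤP.+-inverseʳ a)) 5∣0)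

  ≡₅-refl : ∀ {a} → a ≡₅ a
  ≡₅-refl = ≡⇒≡₅ refl

  ≡₅-sym : ∀ {a b} → a ≡₅ b → b ≡₅ a
  ≡₅-sym {a} {b} (mod5 p) = mod5 (subst (+ 5 ∣_) (lemma a b) (∣m⇒∣-m p))
    where lemma : ∀ a b → - (a - b) ≡ b - a
          lemma = solve-∀

  ≡₅-trans : ∀ {a b c} → a ≡₅ b → b ≡₅ c → a ≡₅ c
  ≡₅-trans {a} {b} {c} (mod5 p) (mod5 q) = mod5 (subst (+ 5 ∣_) (lemma a b c) (∣m∣n⇒∣m+n p q))
    where lemma : ∀ a b c → (a - b) + (b - c) ≡ a - c
          lemma = solve-∀

  ≡₅-+ : ∀ {a a′ b b′} → a ≡₅ a′ → b ≡₅ b′ → a + b ≡₅ a′ + b′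
  ≡₅-+ {a} {a′} {b} {b′} (mod5 p) (mod5 q) = mod5 (subst (+ 5 ∣_) (lemma a a′ b b′) (∣m∣n⇒∣m+n p q))
    where lemma : ∀ a a′ b b′ → (a - a′) + (b - b′) ≡ (a + b) - (a′ + b′)
          lemma = solve-∀

  ≡₅-neg : ∀ {a a′} → a ≡₅ a′ → - a ≡₅ - a′
  ≡₅-neg {a} {a′} (mod5 p) = mod5 (subst (+ 5 ∣_) (lemma a a′) (∣m⇒∣-m p))
    where lemma : ∀ a a′ → - (a - a′) ≡ - a - - a′
          lemma = solve-∀

  ≡₅-* : ∀ {a a′ b b′} → a ≡₅ a′ → b ≡₅ b′ → a * b ≡₅ a′ * b′
  ≡₅-* {a} {a′} {b} {b′} (mod5 p) (mod5 q) =
    mod5 (subst (+ 5 ∣_) (lemma a a′ b b′) (∣m∣n⇒∣m+n (∣m⇒∣m*n b p) (∣n⇒∣m*n a′ q)))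
    where lemma : ∀ a a′ b b′ → (a - a′) * b + a′ * (b - b′) ≡ a * b - a′ * b′
          lemma = solve-∀

  5∣⇒≡₅0 : ∀ {a} → + 5 ∣ a → a ≡₅ 0ℤ
  5∣⇒≡₅0 {a} p = mod5 (subst (+ 5 ∣_) (sym (ℤP.+-identityʳ a)) p)

  5∣-≡₅ : ∀ {a b} → a ≡₅ b → + 5 ∣ b → + 5 ∣ a
  5∣-≡₅ {a} {b} (mod5 p) q = subst (+ 5 ∣_) (lemma a b) (∣m∣n⇒∣m+n p q)
    where lemma : ∀ a b → (a - b) + b ≡ a
          lemma = solve-∀

  5∣-half : ∀ a → + 5 ∣ a + a → + 5 ∣ a
  5∣-half a 5∣2a = subst (+ 5 ∣_) (lemma a) (∣m∣n⇒∣m+n (∣n⇒∣m*n (+ 3) 5∣2a) (∣m⇒∣-m (5∣5* a)))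
    where lemma : ∀ a → + 3 * (a + a) + - (+ 5 * a) ≡ a
          lemma = solve-∀

  5∣-sumTo : ∀ n {f : ℕ → ℤ} → (∀ i → i ≤ n → + 5 ∣ f i) → + 5 ∣ sumTo n f
  5∣-sumTo zero    p = p 0 z≤n
  5∣-sumTo (suc n) p = ∣m∣n⇒∣m+n (5∣-sumTo n (λ i i≤n → p i (ℕP.m≤n⇒m≤1+n i≤n))) (p (suc n) ℕP.≤-refl)

  5∣-sumBelow : ∀ R {f : ℕ → ℤ} → (∀ i → i < R → + 5 ∣ f i) → + 5 ∣ sumBelow R f
  5∣-sumBelow zero    p = 5∣0
  5∣-sumBelow (suc R) p = ∣m∣n⇒∣m+n (5∣-sumBelow R (λ i i<R → p i (ℕP.m≤n⇒m≤1+n i<R))) (p R ℕP.≤-refl)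

  sumTo-≡₅ : ∀ n {f g : ℕ → ℤ} → (∀ i → i ≤ n → f i ≡₅ g i) → sumTo n f ≡₅ sumTo n g
  sumTo-≡₅ zero    p = p 0 z≤n
  sumTo-≡₅ (suc n) p = ≡₅-+ (sumTo-≡₅ n (λ i i≤n → p i (ℕP.m≤n⇒m≤1+n i≤n))) (p (suc n) ℕP.≤-refl)

  sumBelow-≡₅ : ∀ R {f g : ℕ → ℤ} → (∀ i → i < R → f i ≡₅ g i) → sumBelow R f ≡₅ sumBelow R g
  sumBelow-≡₅ zero    p = ≡₅-refl
  sumBelow-≡₅ (suc R) p = ≡₅-+ (sumBelow-≡₅ R (λ i i<R → p i (ℕP.m≤n⇒m≤1+n i<R))) (p R ℕP.≤-refl)

  infix 4 _≋⟨_⟩_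
  record _≋⟨_⟩_ (f : Series) (L : ℕ) (g : Series) : Set where
    constructor mk≋
    field coeff-≡₅ : ∀ d → d < L → f d ≡₅ g d
  open _≋⟨_⟩_ public

  ≋-refl : ∀ {L f} → f ≋⟨ L ⟩ f
  ≋-refl = mk≋ λ d _ → ≡₅-refl

  ≈⇒≋ : ∀ {L f g} → f ≈ g → f ≋⟨ L ⟩ g
  ≈⇒≋ p = mk≋ λ d _ → ≡⇒≡₅ (app p d)

  ≋-sym : ∀ {L f g} → f ≋⟨ L ⟩ g → g ≋⟨ L ⟩ f
  ≋-sym p = mk≋ λ d d<L → ≡₅-sym (coeff-≡₅ p d d<L)

  ≋-trans : ∀ {L f g h} → f ≋⟨ L ⟩ g → g ≋⟨ L ⟩ h → f ≋⟨ L ⟩ h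
  ≋-trans p q = mk≋ λ d d<L → ≡₅-trans (coeff-≡₅ p d d<L) (coeff-≡₅ q d d<L)

  ≋-weaken : ∀ {L L′ f g} → L′ ≤ L → f ≋⟨ L ⟩ g → f ≋⟨ L′ ⟩ g
  ≋-weaken L′≤L p = mk≋ λ d d<L′ → coeff-≡₅ p d (ℕP.≤-trans d<L′ L′≤L)

  ≋-+ : ∀ {L f f′ g g′} → f ≋⟨ L ⟩ f′ → g ≋⟨ L ⟩ g′ → f +ₛ g ≋⟨ L ⟩ f′ +ₛ g′
  ≋-+ p q = mk≋ λ d d<L → ≡₅-+ (coeff-≡₅ p d d<L) (coeff-≡₅ q d d<L)

  ≋-neg : ∀ {L f f′} → f ≋⟨ L ⟩ f′ → -ₛ f ≋⟨ L ⟩ -ₛ f′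
  ≋-neg p = mk≋ λ d d<L → ≡₅-neg (coeff-≡₅ p d d<L)

  ≋-⊛ : ∀ {L f f′ g g′} → f ≋⟨ L ⟩ f′ → g ≋⟨ L ⟩ g′ → f ⊛ g ≋⟨ L ⟩ f′ ⊛ g′
  ≋-⊛ p q = mk≋ λ d d<L → sumTo-≡₅ d (λ i i≤d →
    ≡₅-* (coeff-≡₅ p i (ℕP.≤-<-trans i≤d d<L)) (coeff-≡₅ q (d ∸ i) (ℕP.≤-<-trans (ℕP.m∸n≤m d i) d<L)))

  ≋-Σₛ : ∀ {L} R {F G} → (∀ i → i < R → F i ≋⟨ L ⟩ G i) → Σₛ R F ≋⟨ L ⟩ Σₛ R G
  ≋-Σₛ R p = mk≋ λ d d<L → sumBelow-≡₅ R (λ i i<R → coeff-≡₅ (p i i<R) d d<L)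

  ≋-shiftBy : ∀ {L} e {f g} → f ≋⟨ L ⟩ g → shiftBy e f ≋⟨ e ℕ.+ L ⟩ shiftBy e g
  ≋-shiftBy zero    p = p
  ≋-shiftBy {L} (suc e) {f} {g} p = mk≋ shifted
    where
    shifted : ∀ d → d < suc (e ℕ.+ L) → shiftBy (suc e) f d ≡₅ shiftBy (suc e) g d
    shifted zero    _         = ≡₅-refl
    shifted (suc d) (s≤s d<L) = coeff-≡₅ (≋-shiftBy e p) d d<L

  ≋-q^⊛ : ∀ {L} e {f g} → f ≋⟨ L ⟩ g → q^ e ⊛ f ≋⟨ e ℕ.+ L ⟩ q^ e ⊛ g
  ≋-q^⊛ e {f} {g} p = ≋-trans (≈⇒≋ (q^-⊛ e f)) (≋-trans (≋-shiftBy e p) (≈⇒≋ (≈-sym (q^-⊛ e g))))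

  q^⊛≋0 : ∀ e f → q^ e ⊛ f ≋⟨ e ⟩ 0ₛ
  q^⊛≋0 e f = ≋-trans (≋-weaken (ℕP.≤-reflexive (sym (ℕP.+-identityʳ e))) (≋-q^⊛ {L = 0} e {f} {0ₛ} (mk≋ λ d ())))
                      (≈⇒≋ (⊛-zeroʳ (q^ e)))

  ι5⊛≋0 : ∀ {L} f → ι (+ 5) ⊛ f ≋⟨ L ⟩ 0ₛ
  ι5⊛≋0 f = mk≋ λ d _ → 5∣⇒≡₅0 (subst (+ 5 ∣_) (sym (ι-⊛ (+ 5) f d)) (5∣5* (f d)))

module Triangular where

  open Congruence5 using (5∣5*)
  open import Data.Nat as ℕ using (ℕ; zero; suc; _∸_; _≤_; z≤n; s≤s; _%_)
  import Data.Nat.Properties as ℕP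
  open import Data.Nat.DivMod using ([m+kn]%n≡m%n)
  open import Data.Integer using (ℤ; +_; -_; _+_; _*_; _-_; 0ℤ; 1ℤ)
  import Data.Integer.Properties as ℤP
  open import Data.Integer.Divisibility.Signed using (_∣_; divides; ∣m∣n⇒∣m+n; ∣m⇒∣-m)
  open import Data.Integer.Tactic.RingSolver as ℤ-Solver using ()
  open import Data.Nat.Tactic.RingSolver as ℕ-Solver using ()
  open import Data.Empty using (⊥-elim)
  open import Data.Product using (_×_; _,_)
  open import Data.Sum using (_⊎_; inj₁; inj₂)
  open import Relation.Binary.PropositionalEquality
  open import Relation.Nullary using (¬_)

  triangular : ℕ → ℕ
  triangular zero    = zero
  triangular (suc k) = suc k ℕ.+ triangular k

  θ : ℕ → ℕ → ℕ
  θ zero    zero    = 0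
  θ zero    (suc n) = triangular (suc n)
  θ (suc i) zero    = triangular i
  θ (suc i) (suc n) = θ i n

  θ-zero : ∀ n → θ 0 n ≡ triangular n
  θ-zero zero    = refl
  θ-zero (suc n) = refl

  double : ℕ → ℕ
  double zero    = zero
  double (suc n) = suc (suc (double n))

  double≡+ : ∀ n → double n ≡ n ℕ.+ n
  double≡+ zero    = refl
  double≡+ (suc n) = cong suc (trans (cong suc (double≡+ n)) (sym (ℕP.+-suc n n)))

  suc+suc-suc≡suc-double : ∀ n → suc n ℕ.+ suc (suc n) ≡ suc (double (suc n))
  suc+suc-suc≡suc-double n = cong suc (trans (ℕP.+-suc n (suc n)) (cong suc (trans (ℕP.+-suc n n) (cong suc (sym (double≡+ n))))))

  sign : ℕ → ℤ
  sign zero    = 1ℤ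
  sign (suc k) = - sign k

  triangular-spec : ∀ k → + triangular k * + 2 ≡ + k * (+ k + 1ℤ)
  triangular-spec zero    = refl
  triangular-spec (suc k) = begin
      (1ℤ + + k + + triangular k) * + 2
    ≡⟨ distrib (+ k) (+ triangular k) ⟩
      (1ℤ + + k) * + 2 + + triangular k * + 2
    ≡⟨ cong (λ t → (1ℤ + + k) * + 2 + t) (triangular-spec k) ⟩
      (1ℤ + + k) * + 2 + + k * (+ k + 1ℤ)
    ≡⟨ collect (+ k) ⟩
      (1ℤ + + k) * ((1ℤ + + k) + 1ℤ) ∎
    where
    open ≡-Reasoning
    distrib : ∀ k t → (1ℤ + k + t) * + 2 ≡ (1ℤ + k) * + 2 + t * + 2
    distrib = ℤ-Solver.solve-∀
    collect : ∀ k → (1ℤ + k) * + 2 + k * (k + 1ℤ) ≡ (1ℤ + k) * ((1ℤ + k) + 1ℤ)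
    collect = ℤ-Solver.solve-∀

  θ-spec : ∀ i n → + θ i n * + 2 ≡ (+ i - + n) * (+ i - + n - 1ℤ)
  θ-spec zero    zero    = refl
  θ-spec zero    (suc n) = trans (triangular-spec (suc n)) (lemma (+ n))
    where lemma : ∀ n → (1ℤ + n) * ((1ℤ + n) + 1ℤ) ≡ (0ℤ - (1ℤ + n)) * (0ℤ - (1ℤ + n) - 1ℤ)
          lemma = ℤ-Solver.solve-∀
  θ-spec (suc i) zero    = trans (triangular-spec i) (lemma (+ i))
    where lemma : ∀ i → i * (i + 1ℤ) ≡ ((1ℤ + i) - 0ℤ) * ((1ℤ + i) - 0ℤ - 1ℤ)
          lemma = ℤ-Solver.solve-∀
  θ-spec (suc i) (suc n) = trans (θ-spec i n) (lemma (+ i) (+ n))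
    where lemma : ∀ i n → (i - n) * (i - n - 1ℤ) ≡ ((1ℤ + i) - (1ℤ + n)) * ((1ℤ + i) - (1ℤ + n) - 1ℤ)
          lemma = ℤ-Solver.solve-∀

  *2-injective : ∀ {a b} → + a * + 2 ≡ + b * + 2 → a ≡ b
  *2-injective {a} {b} eq = ℤP.+-injective (ℤP.*-cancelʳ-≡ (+ a) (+ b) (+ 2) eq)

  θ-reflect : ∀ i j n → i ℕ.+ j ≡ suc (n ℕ.+ n) → θ j n ≡ θ i n
  θ-reflect i j n i+j≡2n+1 = *2-injective (begin
      + θ j n * + 2
    ≡⟨ θ-spec j n ⟩
      (+ j - + n) * (+ j - + n - 1ℤ)
    ≡⟨ cong (λ t → (t - + n) * (t - + n - 1ℤ)) j≡ ⟩
      ((1ℤ + (+ n + + n)) - + i - + n) * ((1ℤ + (+ n + + n)) - + i - + n - 1ℤ)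
    ≡⟨ reflect (+ i) (+ n) ⟩
      (+ i - + n) * (+ i - + n - 1ℤ)
    ≡⟨ sym (θ-spec i n) ⟩
      + θ i n * + 2 ∎)
    where
    open ≡-Reasoning
    j≡ : + j ≡ (1ℤ + (+ n + + n)) - + i
    j≡ = trans (sym (cancel (+ i) (+ j))) (cong (λ t → + t - + i) i+j≡2n+1)
      where cancel : ∀ a b → (a + b) - a ≡ b
            cancel = ℤ-Solver.solve-∀
    reflect : ∀ a n → ((1ℤ + (n + n)) - a - n) * ((1ℤ + (n + n)) - a - n - 1ℤ) ≡ (a - n) * (a - n - 1ℤ)
    reflect = ℤ-Solver.solve-∀

  θ-suc-+ : ∀ i n → θ i n ℕ.+ suc i ≡ suc n ℕ.+ θ (suc i) n
  θ-suc-+ i n = *2-injective (begin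
      + (θ i n ℕ.+ suc i) * + 2
    ≡⟨ distrib (+ θ i n) (+ i) ⟩
      + θ i n * + 2 + (1ℤ + + i) * + 2
    ≡⟨ cong (_+ (1ℤ + + i) * + 2) (θ-spec i n) ⟩
      (+ i - + n) * (+ i - + n - 1ℤ) + (1ℤ + + i) * + 2
    ≡⟨ rearrange (+ i) (+ n) ⟩
      (1ℤ + + n) * + 2 + ((1ℤ + + i) - + n) * ((1ℤ + + i) - + n - 1ℤ)
    ≡⟨ cong (λ t → (1ℤ + + n) * + 2 + t) (sym (θ-spec (suc i) n)) ⟩
      (1ℤ + + n) * + 2 + + θ (suc i) n * + 2
    ≡⟨ sym (distrib′ (+ n) (+ θ (suc i) n)) ⟩
      + (suc n ℕ.+ θ (suc i) n) * + 2 ∎)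
    where
    open ≡-Reasoning
    distrib : ∀ t i → (t + (1ℤ + i)) * + 2 ≡ t * + 2 + (1ℤ + i) * + 2
    distrib = ℤ-Solver.solve-∀
    distrib′ : ∀ n t → (1ℤ + n + t) * + 2 ≡ (1ℤ + n) * + 2 + t * + 2
    distrib′ = ℤ-Solver.solve-∀
    rearrange : ∀ i n → (i - n) * (i - n - 1ℤ) + (1ℤ + i) * + 2 ≡ (1ℤ + n) * + 2 + ((1ℤ + i) - n) * ((1ℤ + i) - n - 1ℤ)
    rearrange = ℤ-Solver.solve-∀

  θ-suc-∸ : ∀ k n → k ≤ double n → θ (suc k) n ℕ.+ (double n ∸ k) ≡ n ℕ.+ θ k n
  θ-suc-∸ k n k≤2n = *2-injective (begin
      + (θ (suc k) n ℕ.+ (double n ∸ k)) * + 2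
    ≡⟨ cong (λ t → (+ θ (suc k) n + t) * + 2) (trans (+[m∸n]≡m-n k≤2n) (cong (λ m → + m - + k) (double≡+ n))) ⟩
      (+ θ (suc k) n + ((+ n + + n) - + k)) * + 2
    ≡⟨ distrib (+ θ (suc k) n) (+ n) (+ k) ⟩
      + θ (suc k) n * + 2 + ((+ n + + n) - + k) * + 2
    ≡⟨ cong (_+ ((+ n + + n) - + k) * + 2) (θ-spec (suc k) n) ⟩
      ((1ℤ + + k) - + n) * ((1ℤ + + k) - + n - 1ℤ) + ((+ n + + n) - + k) * + 2
    ≡⟨ rearrange (+ k) (+ n) ⟩
      + n * + 2 + (+ k - + n) * (+ k - + n - 1ℤ)
    ≡⟨ cong (λ t → + n * + 2 + t) (sym (θ-spec k n)) ⟩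
      + n * + 2 + + θ k n * + 2
    ≡⟨ sym (distrib′ (+ n) (+ θ k n)) ⟩
      + (n ℕ.+ θ k n) * + 2 ∎)
    where
    open ≡-Reasoning
    +[m∸n]≡m-n : ∀ {m n} → n ≤ m → + (m ∸ n) ≡ + m - + n
    +[m∸n]≡m-n {m} {n} n≤m = sym (trans (ℤP.m-n≡m⊖n m n) (ℤP.⊖-≥ n≤m))
    distrib : ∀ t n k → (t + ((n + n) - k)) * + 2 ≡ t * + 2 + ((n + n) - k) * + 2
    distrib = ℤ-Solver.solve-∀
    rearrange : ∀ k n → ((1ℤ + k) - n) * ((1ℤ + k) - n - 1ℤ) + ((n + n) - k) * + 2 ≡ n * + 2 + (k - n) * (k - n - 1ℤ)
    rearrange = ℤ-Solver.solve-∀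
    distrib′ : ∀ n t → (n + t) * + 2 ≡ n * + 2 + t * + 2
    distrib′ = ℤ-Solver.solve-∀

  k≤triangular : ∀ k → k ≤ triangular k
  k≤triangular zero    = z≤n
  k≤triangular (suc k) = ℕP.m≤m+n (suc k) (triangular k)

  n≤θ+i : ∀ i n → i ≤ n → n ≤ θ i n ℕ.+ i
  n≤θ+i zero    n       _         = ℕP.≤-trans (ℕP.≤-trans (k≤triangular n) (ℕP.≤-reflexive (sym (θ-zero n)))) (ℕP.m≤m+n (θ 0 n) 0)
  n≤θ+i (suc i) (suc n) (s≤s i≤n) = ℕP.≤-trans (s≤s (n≤θ+i i n i≤n)) (ℕP.≤-reflexive (sym (ℕP.+-suc (θ i n) i)))

  i≤θ+1+n : ∀ i n → n ≤ i → i ≤ θ i n ℕ.+ suc n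
  i≤θ+1+n zero    zero    _         = z≤n
  i≤θ+1+n (suc i) zero    _         = ℕP.≤-trans (s≤s (k≤triangular i)) (ℕP.≤-reflexive (ℕP.+-comm 1 (triangular i)))
  i≤θ+1+n (suc i) (suc n) (s≤s n≤i) = ℕP.≤-trans (s≤s (i≤θ+1+n i n n≤i)) (ℕP.≤-reflexive (sym (ℕP.+-suc (θ i n) (suc n))))

  sign-+ : ∀ x y → sign (x ℕ.+ y) ≡ sign x * sign y
  sign-+ zero    y = sym (ℤP.*-identityˡ (sign y))
  sign-+ (suc x) y = trans (cong -_ (sign-+ x y)) (ℤP.neg-distribˡ-* (sign x) (sign y))

  sign*sign : ∀ x → sign x * sign x ≡ 1ℤ
  sign*sign zero    = refl
  sign*sign (suc x) = trans (neg*neg (sign x)) (sign*sign x)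
    where neg*neg : ∀ a → - a * - a ≡ a * a
          neg*neg = ℤ-Solver.solve-∀

  sign-double : ∀ m → sign (double m) ≡ 1ℤ
  sign-double zero    = refl
  sign-double (suc m) = trans (ℤP.neg-involutive (sign (double m))) (sign-double m)

  sign-suc-suc : ∀ i n → sign (suc i ℕ.+ suc n) ≡ sign (i ℕ.+ n)
  sign-suc-suc i n = trans (cong (λ m → - sign m) (ℕP.+-suc i n)) (ℤP.neg-involutive (sign (i ℕ.+ n)))

  sign-odd : ∀ x y m → x ℕ.+ y ≡ suc (double m) → sign y ≡ - sign x
  sign-odd x y m x+y≡odd = begin
      sign y
    ≡⟨ sym (trans (cong (_* sign y) (sign*sign x)) (ℤP.*-identityˡ (sign y))) ⟩
      (sign x * sign x) * sign y
    ≡⟨ ℤP.*-assoc (sign x) (sign x) (sign y) ⟩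
      sign x * (sign x * sign y)
    ≡⟨ cong (sign x *_) (trans (sym (sign-+ x y)) (trans (cong sign x+y≡odd) (cong -_ (sign-double m)))) ⟩
      sign x * - 1ℤ
    ≡⟨ ℤP.*-comm (sign x) (- 1ℤ) ⟩
      - 1ℤ * sign x
    ≡⟨ ℤP.-1*i≡-i (sign x) ⟩
      - sign x ∎
    where open ≡-Reasoning

  Residue≥2 : ℕ → Set
  Residue≥2 e = ¬ (e % 5 ≡ 0) × ¬ (e % 5 ≡ 1)

  triangular-5+ : ∀ k → triangular (5 ℕ.+ k) % 5 ≡ triangular k % 5
  triangular-5+ k = trans (cong (_% 5) (expand k (triangular k))) ([m+kn]%n≡m%n (triangular k) (k ℕ.+ 3) 5)
    where expand : ∀ k t → (5 ℕ.+ k) ℕ.+ ((4 ℕ.+ k) ℕ.+ ((3 ℕ.+ k) ℕ.+ ((2 ℕ.+ k) ℕ.+ ((1 ℕ.+ k) ℕ.+ t)))) ≡ t ℕ.+ (k ℕ.+ 3) ℕ.* 5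
          expand = ℕ-Solver.solve-∀

  triangular-mod5 : ∀ k → (triangular k % 5 ≡ 0) ⊎ (triangular k % 5 ≡ 1) ⊎ (+ 5 ∣ + (suc (k ℕ.+ k)))
  triangular-mod5 0 = inj₁ refl
  triangular-mod5 1 = inj₂ (inj₁ refl)
  triangular-mod5 2 = inj₂ (inj₂ (divides (+ 1) refl))
  triangular-mod5 3 = inj₂ (inj₁ refl)
  triangular-mod5 4 = inj₁ refl
  triangular-mod5 (suc (suc (suc (suc (suc k))))) with triangular-mod5 k
  ... | inj₁ r≡0        = inj₁ (trans (triangular-5+ k) r≡0)
  ... | inj₂ (inj₁ r≡1) = inj₂ (inj₁ (trans (triangular-5+ k) r≡1))
  ... | inj₂ (inj₂ 5∣)  = inj₂ (inj₂ (subst (+ 5 ∣_) (cong +_ (expand k)) (∣m∣n⇒∣m+n 5∣ (5∣5* (+ 2)))))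
    where expand : ∀ k → (1 ℕ.+ (k ℕ.+ k)) ℕ.+ 10 ≡ 6 ℕ.+ (k ℕ.+ (5 ℕ.+ k))
          expand = ℕ-Solver.solve-∀

  θ-mod5 : ∀ a n → Residue≥2 (θ a n) → + 5 ∣ + a * + 2 - (+ n * + 2 + 1ℤ)
  θ-mod5 zero    zero    (r≢0 , _) = ⊥-elim (r≢0 refl)
  θ-mod5 zero    (suc n) (r≢0 , r≢1) with triangular-mod5 (suc n)
  ... | inj₁ r≡0        = ⊥-elim (r≢0 r≡0)
  ... | inj₂ (inj₁ r≡1) = ⊥-elim (r≢1 r≡1)
  ... | inj₂ (inj₂ 5∣)  = subst (+ 5 ∣_) (lemma (+ n)) (∣m⇒∣-m 5∣)
    where lemma : ∀ n → - (1ℤ + ((1ℤ + n) + (1ℤ + n))) ≡ 0ℤ * + 2 - ((1ℤ + n) * + 2 + 1ℤ)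
          lemma = ℤ-Solver.solve-∀
  θ-mod5 (suc a) zero    (r≢0 , r≢1) with triangular-mod5 a
  ... | inj₁ r≡0        = ⊥-elim (r≢0 r≡0)
  ... | inj₂ (inj₁ r≡1) = ⊥-elim (r≢1 r≡1)
  ... | inj₂ (inj₂ 5∣)  = subst (+ 5 ∣_) (lemma (+ a)) 5∣
    where lemma : ∀ a → 1ℤ + (a + a) ≡ (1ℤ + a) * + 2 - (0ℤ * + 2 + 1ℤ)
          lemma = ℤ-Solver.solve-∀
  θ-mod5 (suc a) (suc n) r = subst (+ 5 ∣_) (lemma (+ a) (+ n)) (θ-mod5 a n r)
    where lemma : ∀ a n → a * + 2 - (n * + 2 + 1ℤ) ≡ (1ℤ + a) * + 2 - ((1ℤ + n) * + 2 + 1ℤ)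
          lemma = ℤ-Solver.solve-∀

module GaussianBinomial (s : ℕ) where

  open PowerSeries
  open import Data.Nat as ℕ using (ℕ; zero; suc; _∸_; _≤_; _<_; s≤s)
  import Data.Nat.Properties as ℕP
  open import Data.Integer using (1ℤ)
  open import Relation.Binary.PropositionalEquality
  open import Relation.Nullary using (yes; no)
  open SeriesSolver using (solve; _:=_; _:+_; _:*_; _:-_; con)

  x^_ : ℕ → Series
  x^ e = q^ (s ℕ.* e)

  x^-+ : ∀ a b → x^ a ⊛ x^ b ≈ x^ (a ℕ.+ b)
  x^-+ a b = ≈-trans (q^-+ (s ℕ.* a) (s ℕ.* b)) (q^-≡ (sym (ℕP.*-distribˡ-+ s a b)))

  x^-≡ : ∀ {a b} → a ≡ b → x^ a ≈ x^ b
  x^-≡ refl = ≈-refl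

  x^0 : x^ 0 ≈ 1ₛ
  x^0 = ≈-trans (q^-≡ (ℕP.*-zeroʳ s)) one≈1ₛ

  qbinom : ℕ → ℕ → Series
  qbinom M       zero    = one
  qbinom zero    (suc m) = 0ₛ
  qbinom (suc M) (suc m) = qbinom M m +ₛ x^ (suc m) ⊛ qbinom M (suc m)

  qbinom-vanish : ∀ M m → M < m → qbinom M m ≈ 0ₛ
  qbinom-vanish zero    (suc m) _         = ≈-refl
  qbinom-vanish (suc M) (suc m) (s≤s M<m) = ≈-trans
    (+ₛ-cong (qbinom-vanish M m M<m)
             (≈-trans (⊛-congˡ (x^ (suc m)) (qbinom-vanish M (suc m) (ℕP.m≤n⇒m≤1+n M<m))) (⊛-zeroʳ (x^ (suc m)))))
    (+ₛ-identityˡ 0ₛ)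

  x^-x^-qbinom : ∀ a b c e M k → (k ≤ M → a ℕ.+ b ≡ c ℕ.+ e) →
    x^ a ⊛ (x^ b ⊛ qbinom M k) ≈ x^ c ⊛ (x^ e ⊛ qbinom M k)
  x^-x^-qbinom a b c e M k exponents with k ℕP.≤? M
  ... | yes k≤M = begin
      x^ a ⊛ (x^ b ⊛ qbinom M k)
    ≈⟨ ≈-sym (⊛-assoc (x^ a) (x^ b) (qbinom M k)) ⟩
      (x^ a ⊛ x^ b) ⊛ qbinom M k
    ≈⟨ ⊛-congʳ (qbinom M k) (≈-trans (x^-+ a b) (≈-trans (x^-≡ (exponents k≤M)) (≈-sym (x^-+ c e)))) ⟩
      (x^ c ⊛ x^ e) ⊛ qbinom M k
    ≈⟨ ⊛-assoc (x^ c) (x^ e) (qbinom M k) ⟩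
      x^ c ⊛ (x^ e ⊛ qbinom M k) ∎
    where open ≈-Reasoning
  ... | no k≰M = ≈-trans (vanish a b) (≈-sym (vanish c e))
    where
    vanish : ∀ u v → x^ u ⊛ (x^ v ⊛ qbinom M k) ≈ 0ₛ
    vanish u v = ≈-trans
      (⊛-congˡ (x^ u) (≈-trans (⊛-congˡ (x^ v) (qbinom-vanish M k (ℕP.≰⇒> k≰M))) (⊛-zeroʳ (x^ v))))
      (⊛-zeroʳ (x^ u))

  x^-x^-qbinom-merge : ∀ a b c M k → (k ≤ M → a ℕ.+ b ≡ c) → x^ a ⊛ (x^ b ⊛ qbinom M k) ≈ x^ c ⊛ qbinom M k
  x^-x^-qbinom-merge a b c M k exponents =
    ≈-trans (x^-x^-qbinom a b c 0 M k (λ k≤M → trans (exponents k≤M) (sym (ℕP.+-identityʳ c))))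
            (⊛-congˡ (x^ c) (≈-trans (⊛-congʳ (qbinom M k) (≈-trans x^0 (≈-sym one≈1ₛ))) (⊛-identityˡ (qbinom M k))))

  qbinom-pascal-zero : ∀ M → qbinom (suc M) 1 ≈ x^ M ⊛ one +ₛ qbinom M 1
  qbinom-pascal-zero zero = begin
      one +ₛ x^ 1 ⊛ 0ₛ
    ≈⟨ +ₛ-cong (≈-sym (⊛-identityʳ one)) (⊛-zeroʳ (x^ 1)) ⟩
      one ⊛ one +ₛ 0ₛ
    ≈⟨ +ₛ-congʳ 0ₛ (⊛-congʳ one (≈-sym (≈-trans x^0 (≈-sym one≈1ₛ)))) ⟩
      x^ 0 ⊛ one +ₛ 0ₛ ∎
    where open ≈-Reasoning
  qbinom-pascal-zero (suc M) = begin
      one +ₛ x^ 1 ⊛ (one +ₛ x^ 1 ⊛ qbinom M 1)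
    ≈⟨ solve 3 (λ o x y → o :+ x :* (o :+ x :* y) := o :+ x :* o :+ x :* (x :* y)) ≈-refl one (x^ 1) (qbinom M 1) ⟩
      one +ₛ x^ 1 ⊛ one +ₛ x^ 1 ⊛ (x^ 1 ⊛ qbinom M 1)
    ≈⟨ +ₛ-congˡ (one +ₛ x^ 1 ⊛ one) (⊛-congˡ (x^ 1) x^1⊛qbinom) ⟩
      one +ₛ x^ 1 ⊛ one +ₛ x^ 1 ⊛ (x^ M ⊛ one +ₛ qbinom M 1 -ₛ one)
    ≈⟨ solve 4 (λ o x xM y → o :+ x :* o :+ x :* (xM :* o :+ y :- o) := (x :* xM) :* o :+ (o :+ x :* y))
             ≈-refl one (x^ 1) (x^ M) (qbinom M 1) ⟩
      (x^ 1 ⊛ x^ M) ⊛ one +ₛ (one +ₛ x^ 1 ⊛ qbinom M 1)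
    ≈⟨ +ₛ-congʳ (one +ₛ x^ 1 ⊛ qbinom M 1) (⊛-congʳ one (x^-+ 1 M)) ⟩
      x^ (suc M) ⊛ one +ₛ (one +ₛ x^ 1 ⊛ qbinom M 1) ∎
    where
    open ≈-Reasoning
    x^1⊛qbinom : x^ 1 ⊛ qbinom M 1 ≈ x^ M ⊛ one +ₛ qbinom M 1 -ₛ one
    x^1⊛qbinom = ≈-trans (solve 3 (λ o x y → x :* y := (o :+ x :* y) :- o) ≈-refl one (x^ 1) (qbinom M 1))
                         (+ₛ-congʳ (-ₛ one) (qbinom-pascal-zero M))

  qbinom-pascal : ∀ M m → qbinom (suc M) (suc m) ≈ x^ (M ∸ m) ⊛ qbinom M m +ₛ qbinom M (suc m)
  qbinom-pascal M       zero    = qbinom-pascal-zero M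
  qbinom-pascal zero    (suc m) =
    ≈-trans (+ₛ-congˡ 0ₛ (⊛-zeroʳ (x^ (suc (suc m))))) (≈-sym (+ₛ-congʳ 0ₛ (⊛-zeroʳ (x^ 0))))
  qbinom-pascal (suc M) (suc m) = begin
      qbinom (suc M) (suc m) +ₛ x₂ ⊛ qbinom (suc M) (suc (suc m))
    ≈⟨ +ₛ-cong (qbinom-pascal M m) (⊛-congˡ x₂ (qbinom-pascal M (suc m))) ⟩
      (y ⊛ b₀ +ₛ b₁) +ₛ x₂ ⊛ (y′ ⊛ b₁ +ₛ b₂)
    ≈⟨ solve 6 (λ y b₀ b₁ x₂ y′ b₂ → (y :* b₀ :+ b₁) :+ x₂ :* (y′ :* b₁ :+ b₂)
                                   := y :* b₀ :+ b₁ :+ x₂ :* (y′ :* b₁) :+ x₂ :* b₂)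
             ≈-refl y b₀ b₁ x₂ y′ b₂ ⟩
      y ⊛ b₀ +ₛ b₁ +ₛ x₂ ⊛ (y′ ⊛ b₁) +ₛ x₂ ⊛ b₂
    ≈⟨ +ₛ-congʳ (x₂ ⊛ b₂) (+ₛ-congˡ (y ⊛ b₀ +ₛ b₁) swap) ⟩
      y ⊛ b₀ +ₛ b₁ +ₛ y ⊛ (x₁ ⊛ b₁) +ₛ x₂ ⊛ b₂
    ≈⟨ solve 6 (λ y b₀ b₁ x₂ x₁ b₂ → y :* b₀ :+ b₁ :+ y :* (x₁ :* b₁) :+ x₂ :* b₂
                                   := y :* (b₀ :+ x₁ :* b₁) :+ (b₁ :+ x₂ :* b₂))
             ≈-refl y b₀ b₁ x₂ x₁ b₂ ⟩
      y ⊛ (b₀ +ₛ x₁ ⊛ b₁) +ₛ (b₁ +ₛ x₂ ⊛ b₂) ∎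
    where
    open ≈-Reasoning
    x₁ = x^ (suc m)
    x₂ = x^ (suc (suc m))
    y  = x^ (M ∸ m)
    y′ = x^ (M ∸ suc m)
    b₀ = qbinom M m
    b₁ = qbinom M (suc m)
    b₂ = qbinom M (suc (suc m))
    swap : x₂ ⊛ (y′ ⊛ b₁) ≈ y ⊛ (x₁ ⊛ b₁)
    swap = x^-x^-qbinom (suc (suc m)) (M ∸ suc m) (M ∸ m) (suc m) M (suc m) (λ 1+m≤M →
      trans (cong suc (ℕP.+-comm (suc m) (M ∸ suc m))) (cong (ℕ._+ suc m) (sym (ℕP.+-∸-assoc 1 1+m≤M))))

  qbinom-suc-suc : ∀ M m → qbinom (suc (suc M)) (suc m) ≈
    (1ₛ +ₛ x^ (suc M)) ⊛ qbinom M m +ₛ delay (λ k → x^ (M ∸ k) ⊛ qbinom M k) m +ₛ x^ (suc m) ⊛ qbinom M (suc m)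
  qbinom-suc-suc M zero = begin
      one +ₛ x^ 1 ⊛ qbinom (suc M) 1
    ≈⟨ +ₛ-congˡ one (⊛-congˡ (x^ 1) (qbinom-pascal M 0)) ⟩
      one +ₛ x^ 1 ⊛ (x^ M ⊛ one +ₛ qbinom M 1)
    ≈⟨ solve 4 (λ o x₁ y b → o :+ x₁ :* (y :* o :+ b) := o :+ x₁ :* (y :* o) :+ x₁ :* b) ≈-refl one (x^ 1) (x^ M) (qbinom M 1) ⟩
      one +ₛ x^ 1 ⊛ (x^ M ⊛ one) +ₛ x^ 1 ⊛ qbinom M 1
    ≈⟨ +ₛ-congʳ (x^ 1 ⊛ qbinom M 1) (+ₛ-congˡ one (≈-trans (x^-x^-qbinom-merge 1 M (suc M) M 0 (λ _ → refl)) (⊛-identityʳ (x^ (suc M))))) ⟩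
      one +ₛ x^ (suc M) +ₛ x^ 1 ⊛ qbinom M 1
    ≈⟨ +ₛ-congʳ (x^ 1 ⊛ qbinom M 1) (≈-sym (≈-trans (+ₛ-identityʳ _)
         (≈-trans (⊛-identityʳ (1ₛ +ₛ x^ (suc M))) (+ₛ-congʳ (x^ (suc M)) (≈-sym one≈1ₛ))))) ⟩
      (1ₛ +ₛ x^ (suc M)) ⊛ one +ₛ 0ₛ +ₛ x^ 1 ⊛ qbinom M 1 ∎
    where open ≈-Reasoning
  qbinom-suc-suc M (suc k) = begin
      qbinom (suc M) (suc k) +ₛ x₂ ⊛ qbinom (suc M) (suc (suc k))
    ≈⟨ +ₛ-cong (qbinom-pascal M k) (⊛-congˡ x₂ (qbinom-pascal M (suc k))) ⟩
      (y ⊛ b₀ +ₛ b₁) +ₛ x₂ ⊛ (y′ ⊛ b₁ +ₛ b₂)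
    ≈⟨ solve 6 (λ y b₀ b₁ x₂ y′ b₂ → (y :* b₀ :+ b₁) :+ x₂ :* (y′ :* b₁ :+ b₂)
                                   := b₁ :+ x₂ :* (y′ :* b₁) :+ y :* b₀ :+ x₂ :* b₂)
             ≈-refl y b₀ b₁ x₂ y′ b₂ ⟩
      b₁ +ₛ x₂ ⊛ (y′ ⊛ b₁) +ₛ y ⊛ b₀ +ₛ x₂ ⊛ b₂
    ≈⟨ +ₛ-congʳ (x₂ ⊛ b₂) (+ₛ-congʳ (y ⊛ b₀) (+ₛ-congˡ b₁
         (x^-x^-qbinom-merge (suc (suc k)) (M ∸ suc k) (suc M) M (suc k) (λ 1+k≤M → cong suc (ℕP.m+[n∸m]≡n 1+k≤M))))) ⟩
      b₁ +ₛ x^ (suc M) ⊛ b₁ +ₛ y ⊛ b₀ +ₛ x₂ ⊛ b₂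
    ≈⟨ solve 5 (λ xM b₁ y b₀ z → b₁ :+ xM :* b₁ :+ y :* b₀ :+ z := (con 1ℤ :+ xM) :* b₁ :+ y :* b₀ :+ z)
             ≈-refl (x^ (suc M)) b₁ y b₀ (x₂ ⊛ b₂) ⟩
      (1ₛ +ₛ x^ (suc M)) ⊛ b₁ +ₛ y ⊛ b₀ +ₛ x₂ ⊛ b₂ ∎
    where
    open ≈-Reasoning
    x₂ = x^ (suc (suc k))
    y  = x^ (M ∸ k)
    y′ = x^ (M ∸ suc k)
    b₀ = qbinom M k
    b₁ = qbinom M (suc k)
    b₂ = qbinom M (suc (suc k))

module Jacobi (s : ℕ) .{{_ : NonZero s}} where

  open PowerSeries
  open Congruence5
  open Triangular
  open GaussianBinomial s
  open import Data.Nat as ℕ using (ℕ; zero; suc; _∸_; _≤_; _<_; z≤n; s≤s)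
  import Data.Nat.Properties as ℕP
  open import Data.Integer using (ℤ; +_; -_; _+_; _*_; _-_; 0ℤ; 1ℤ)
  import Data.Integer.Properties as ℤP
  open import Data.Sum using (inj₁; inj₂)
  open import Function using (_∘_)
  open import Data.Empty using (⊥-elim)
  open import Relation.Binary.PropositionalEquality
  open import Relation.Nullary using (yes; no)
  open import Algebra.Properties.CommutativeSemigroup ℕP.+-commutativeSemigroup using (x∙yz≈y∙xz)
  open import Data.Integer.Divisibility.Signed using (_∣_; ∣n⇒∣m*n; ∣m⇒∣m*n)
  open import Data.Integer.Tactic.RingSolver as ℤ-Solver using ()
  open import Data.Nat.Tactic.RingSolver as ℕ-Solver using ()
  open SeriesSolver using (solve; _:=_; _:+_; _:*_; _:-_; :-_; con)

  xPoch : ℕ → Series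
  xPoch m = prodTo m (λ k → 1ₛ -ₛ x^ k)

  -- Σ_i jacobiTerm n i z^i = (-1)^n x^{n(n+1)/2} Π_{-n ≤ j < n} (1 - z x^j), by the q-binomial theorem.
  jacobiTerm : ℕ → ℕ → Series
  jacobiTerm n i = ι (sign (i ℕ.+ n)) ⊛ (x^ (θ i n) ⊛ qbinom (double n) i)

  width : ℕ → ℕ
  width n = suc (double n)

  jacobiTerm-vanish : ∀ n i → width n ≤ i → jacobiTerm n i ≈ 0ₛ
  jacobiTerm-vanish n i 2n<i = ≈-trans
    (⊛-congˡ (ι (sign (i ℕ.+ n))) (≈-trans (⊛-congˡ (x^ (θ i n)) (qbinom-vanish (double n) i 2n<i)) (⊛-zeroʳ (x^ (θ i n)))))
    (⊛-zeroʳ (ι (sign (i ℕ.+ n))))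

  α β γ : ℕ → Series
  α n = 1ₛ +ₛ x^ (suc (double n))
  β n = -ₛ x^ n
  γ n = -ₛ x^ (suc n)

  jacobiTerm-γ : ∀ n i → ι (sign (i ℕ.+ n)) ⊛ (x^ (θ i n) ⊛ (x^ (suc i) ⊛ qbinom (double n) (suc i))) ≈ γ n ⊛ jacobiTerm n (suc i)
  jacobiTerm-γ n i = begin
      ι σ ⊛ (x^ (θ i n) ⊛ (x^ (suc i) ⊛ b))
    ≈⟨ ⊛-congˡ (ι σ) (x^-x^-qbinom (θ i n) (suc i) (suc n) (θ (suc i) n) (double n) (suc i) (λ _ → θ-suc-+ i n)) ⟩
      ι σ ⊛ (x^ (suc n) ⊛ (x^ (θ (suc i) n) ⊛ b))
    ≈⟨ solve 4 (λ c x t b → c :* (x :* (t :* b)) := (:- x) :* ((:- c) :* (t :* b))) ≈-refl (ι σ) (x^ (suc n)) (x^ (θ (suc i) n)) b ⟩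
      (-ₛ x^ (suc n)) ⊛ ((-ₛ ι σ) ⊛ (x^ (θ (suc i) n) ⊛ b))
    ≈⟨ ⊛-congˡ (-ₛ x^ (suc n)) (⊛-congʳ (x^ (θ (suc i) n) ⊛ b) (≈-sym (ι-neg σ))) ⟩
      γ n ⊛ jacobiTerm n (suc i) ∎
    where
    open ≈-Reasoning
    σ = sign (i ℕ.+ n)
    b = qbinom (double n) (suc i)

  jacobiTerm-β : ∀ n i → ι (sign (i ℕ.+ n)) ⊛ (x^ (θ i n) ⊛ delay (λ k → x^ (double n ∸ k) ⊛ qbinom (double n) k) i)
                           ≈ β n ⊛ delay (jacobiTerm n) i
  jacobiTerm-β n zero = ≈-trans (⊛-congˡ (ι (sign n)) (⊛-zeroʳ (x^ (θ 0 n))))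
                                (≈-trans (⊛-zeroʳ (ι (sign n))) (≈-sym (⊛-zeroʳ (β n))))
  jacobiTerm-β n (suc k) = begin
      ι (- sign (k ℕ.+ n)) ⊛ (x^ (θ (suc k) n) ⊛ (x^ (M ∸ k) ⊛ qbinom M k))
    ≈⟨ ⊛-cong (ι-neg (sign (k ℕ.+ n))) (x^-x^-qbinom (θ (suc k) n) (M ∸ k) n (θ k n) M k (θ-suc-∸ k n)) ⟩
      (-ₛ ι (sign (k ℕ.+ n))) ⊛ (x^ n ⊛ (x^ (θ k n) ⊛ qbinom M k))
    ≈⟨ solve 4 (λ c x t b → (:- c) :* (x :* (t :* b)) := (:- x) :* (c :* (t :* b)))
             ≈-refl (ι (sign (k ℕ.+ n))) (x^ n) (x^ (θ k n)) (qbinom M k) ⟩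
      β n ⊛ jacobiTerm n k ∎
    where
    open ≈-Reasoning
    M = double n

  -- Passing from n to n + 1 multiplies the generating polynomial by  - x^{n+1} (1 - z x^{-n-1}) (1 - z x^n).
  jacobiTerm-suc : ∀ n i →
    jacobiTerm (suc n) i ≈ α n ⊛ delay (jacobiTerm n) i +ₛ β n ⊛ delay (delay (jacobiTerm n)) i +ₛ γ n ⊛ jacobiTerm n i
  jacobiTerm-suc n zero = begin
      ι (sign (suc n)) ⊛ (x^ (triangular (suc n)) ⊛ one)
    ≈⟨ ⊛-cong (ι-neg (sign n)) (⊛-congʳ one (≈-trans (x^-≡ (cong (suc n ℕ.+_) (sym (θ-zero n)))) (≈-sym (x^-+ (suc n) (θ 0 n))))) ⟩
      (-ₛ ι (sign n)) ⊛ ((x^ (suc n) ⊛ x^ (θ 0 n)) ⊛ one)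
    ≈⟨ solve 6 (λ c x t o a b → (:- c) :* ((x :* t) :* o) := a :* con 0ℤ :+ b :* con 0ℤ :+ (:- x) :* (c :* (t :* o)))
             ≈-refl (ι (sign n)) (x^ (suc n)) (x^ (θ 0 n)) one (α n) (β n) ⟩
      α n ⊛ ι 0ℤ +ₛ β n ⊛ ι 0ℤ +ₛ γ n ⊛ jacobiTerm n 0
    ≈⟨ +ₛ-congʳ (γ n ⊛ jacobiTerm n 0) (+ₛ-cong (⊛-congˡ (α n) (≈-sym 0ₛ≈ι0)) (⊛-congˡ (β n) (≈-sym 0ₛ≈ι0))) ⟩
      α n ⊛ 0ₛ +ₛ β n ⊛ 0ₛ +ₛ γ n ⊛ jacobiTerm n 0 ∎
    where open ≈-Reasoning
  jacobiTerm-suc n (suc i) = begin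
      ι (sign (suc i ℕ.+ suc n)) ⊛ (t ⊛ qbinom (suc (suc M)) (suc i))
    ≈⟨ ⊛-cong (ext λ d → cong (λ z → ι z d) (sign-suc-suc i n)) (⊛-congˡ t (qbinom-suc-suc M i)) ⟩
      ι σ ⊛ (t ⊛ ((1ₛ +ₛ x^ (suc M)) ⊛ b₀ +ₛ b₋ +ₛ x₁ ⊛ b₁))
    ≈⟨ solve 7 (λ c t xM b₀ b₋ x₁ b₁ → c :* (t :* ((con 1ℤ :+ xM) :* b₀ :+ b₋ :+ x₁ :* b₁))
                  := (con 1ℤ :+ xM) :* (c :* (t :* b₀)) :+ c :* (t :* b₋) :+ c :* (t :* (x₁ :* b₁)))
             ≈-refl (ι σ) t (x^ (suc M)) b₀ b₋ x₁ b₁ ⟩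
      α n ⊛ jacobiTerm n i +ₛ ι σ ⊛ (t ⊛ b₋) +ₛ ι σ ⊛ (t ⊛ (x₁ ⊛ b₁))
    ≈⟨ +ₛ-cong (+ₛ-congˡ (α n ⊛ jacobiTerm n i) (jacobiTerm-β n i)) (jacobiTerm-γ n i) ⟩
      α n ⊛ jacobiTerm n i +ₛ β n ⊛ delay (jacobiTerm n) i +ₛ γ n ⊛ jacobiTerm n (suc i) ∎
    where
    open ≈-Reasoning
    M  = double n
    σ  = sign (i ℕ.+ n)
    t  = x^ (θ i n)
    x₁ = x^ (suc i)
    b₀ = qbinom M i
    b₁ = qbinom M (suc i)
    b₋ = delay (λ k → x^ (M ∸ k) ⊛ qbinom M k) i

  Σjacobi ∂Σjacobi : ℕ → Series
  Σjacobi  n = Σₛ (width n) (jacobiTerm n)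
  ∂Σjacobi n = ∂Σₛ (width n) (jacobiTerm n)

  Σjacobi-suc : ∀ n → Σjacobi (suc n) ≈ α n ⊛ Σjacobi n +ₛ β n ⊛ Σjacobi n +ₛ γ n ⊛ Σjacobi n
  Σjacobi-suc n = begin
      Σₛ (suc (suc R)) (jacobiTerm (suc n))
    ≈⟨ Σₛ-cong (suc (suc R)) (λ i _ → jacobiTerm-suc n i) ⟩
      Σₛ (suc (suc R)) (λ i → α n ⊛ delay H i +ₛ β n ⊛ delay (delay H) i +ₛ γ n ⊛ H i)
    ≈⟨ Σₛ-linear₃ (suc (suc R)) (α n) (β n) (γ n) (delay H) (delay (delay H)) H ⟩
      α n ⊛ Σₛ (suc (suc R)) (delay H) +ₛ β n ⊛ Σₛ (suc (suc R)) (delay (delay H)) +ₛ γ n ⊛ Σₛ (suc (suc R)) H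
    ≈⟨ +ₛ-cong (+ₛ-cong (⊛-congˡ (α n) (≈-trans (Σₛ-delay (suc R) H) (Σₛ-pad R 1 H (jacobiTerm-vanish n))))
                        (⊛-congˡ (β n) (≈-trans (Σₛ-delay (suc R) (delay H)) (Σₛ-delay R H))))
               (⊛-congˡ (γ n) (Σₛ-pad R 2 H (jacobiTerm-vanish n))) ⟩
      α n ⊛ Σjacobi n +ₛ β n ⊛ Σjacobi n +ₛ γ n ⊛ Σjacobi n ∎
    where
    open ≈-Reasoning
    R = width n
    H = jacobiTerm n

  ∂Σjacobi-suc : ∀ n → ∂Σjacobi (suc n) ≈
    α n ⊛ (∂Σjacobi n +ₛ Σjacobi n) +ₛ β n ⊛ ((∂Σjacobi n +ₛ Σjacobi n) +ₛ Σjacobi n) +ₛ γ n ⊛ ∂Σjacobi n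
  ∂Σjacobi-suc n = begin
      Σₛ (suc (suc R)) (λ i → ι (+ i) ⊛ jacobiTerm (suc n) i)
    ≈⟨ Σₛ-cong (suc (suc R)) (λ i _ → ≈-trans (⊛-congˡ (ι (+ i)) (jacobiTerm-suc n i))
          (solve 7 (λ c a b g h₁ h₂ h₀ → c :* (a :* h₁ :+ b :* h₂ :+ g :* h₀) := a :* (c :* h₁) :+ b :* (c :* h₂) :+ g :* (c :* h₀))
                 ≈-refl (ι (+ i)) (α n) (β n) (γ n) (delay H i) (delay (delay H) i) (H i))) ⟩
      Σₛ (suc (suc R)) (λ i → α n ⊛ (ι (+ i) ⊛ delay H i) +ₛ β n ⊛ (ι (+ i) ⊛ delay (delay H) i) +ₛ γ n ⊛ (ι (+ i) ⊛ H i))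
    ≈⟨ Σₛ-linear₃ (suc (suc R)) (α n) (β n) (γ n)
         (λ i → ι (+ i) ⊛ delay H i) (λ i → ι (+ i) ⊛ delay (delay H) i) (λ i → ι (+ i) ⊛ H i) ⟩
      α n ⊛ ∂Σₛ (suc (suc R)) (delay H) +ₛ β n ⊛ ∂Σₛ (suc (suc R)) (delay (delay H)) +ₛ γ n ⊛ ∂Σₛ (suc (suc R)) H
    ≈⟨ +ₛ-cong (+ₛ-cong (⊛-congˡ (α n) (≈-trans (∂Σₛ-delay (suc R) H)
                                                 (+ₛ-cong (∂Σₛ-pad R 1 H (jacobiTerm-vanish n)) (Σₛ-pad R 1 H (jacobiTerm-vanish n)))))
                        (⊛-congˡ (β n) (≈-trans (∂Σₛ-delay (suc R) (delay H)) (+ₛ-cong (∂Σₛ-delay R H) (Σₛ-delay R H)))))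
               (⊛-congˡ (γ n) (∂Σₛ-pad R 2 H (jacobiTerm-vanish n))) ⟩
      α n ⊛ (∂Σjacobi n +ₛ Σjacobi n) +ₛ β n ⊛ ((∂Σjacobi n +ₛ Σjacobi n) +ₛ Σjacobi n) +ₛ γ n ⊛ ∂Σjacobi n ∎
    where
    open ≈-Reasoning
    R = width n
    H = jacobiTerm n

  Σjacobi-zero : Σjacobi 0 ≈ 1ₛ
  Σjacobi-zero = ≈-trans (+ₛ-identityˡ (jacobiTerm 0 0)) (≈-trans (1ₛ-⊛ (x^ 0 ⊛ one)) (≈-trans (⊛-identityʳ (x^ 0)) x^0))

  ∂Σjacobi-zero : ∂Σjacobi 0 ≈ ι 0ℤ
  ∂Σjacobi-zero = ≈-trans (+ₛ-identityˡ (ι (+ 0) ⊛ jacobiTerm 0 0))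
    (ext λ d → trans (ι-⊛ 0ℤ (jacobiTerm 0 0) d) (trans (ℤP.*-zeroˡ (jacobiTerm 0 0 d)) (app 0ₛ≈ι0 d)))

  Σjacobi-suc≈0 : ∀ n → Σjacobi (suc n) ≈ ι 0ℤ
  Σjacobi-suc≈0 zero = begin
      Σjacobi 1
    ≈⟨ Σjacobi-suc 0 ⟩
      α 0 ⊛ Σjacobi 0 +ₛ β 0 ⊛ Σjacobi 0 +ₛ γ 0 ⊛ Σjacobi 0
    ≈⟨ +ₛ-cong (+ₛ-cong (⊛-congˡ (α 0) Σjacobi-zero) (⊛-cong (-ₛ-cong x^0) Σjacobi-zero)) (⊛-congˡ (γ 0) Σjacobi-zero) ⟩
      α 0 ⊛ 1ₛ +ₛ (-ₛ 1ₛ) ⊛ 1ₛ +ₛ γ 0 ⊛ 1ₛ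
    ≈⟨ solve 1 (λ x → (con 1ℤ :+ x) :* con 1ℤ :+ (:- con 1ℤ) :* con 1ℤ :+ (:- x) :* con 1ℤ := con 0ℤ) ≈-refl (x^ 1) ⟩
      ι 0ℤ ∎
    where open ≈-Reasoning
  Σjacobi-suc≈0 (suc n) = begin
      Σjacobi (suc (suc n))
    ≈⟨ Σjacobi-suc (suc n) ⟩
      α (suc n) ⊛ Σjacobi (suc n) +ₛ β (suc n) ⊛ Σjacobi (suc n) +ₛ γ (suc n) ⊛ Σjacobi (suc n)
    ≈⟨ +ₛ-cong (+ₛ-cong (⊛-congˡ (α (suc n)) IH) (⊛-congˡ (β (suc n)) IH)) (⊛-congˡ (γ (suc n)) IH) ⟩
      α (suc n) ⊛ ι 0ℤ +ₛ β (suc n) ⊛ ι 0ℤ +ₛ γ (suc n) ⊛ ι 0ℤ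
    ≈⟨ solve 3 (λ a b c → a :* con 0ℤ :+ b :* con 0ℤ :+ c :* con 0ℤ := con 0ℤ) ≈-refl (α (suc n)) (β (suc n)) (γ (suc n)) ⟩
      ι 0ℤ ∎
    where
    open ≈-Reasoning
    IH = Σjacobi-suc≈0 n

  ∂Σjacobi-suc≈ : ∀ n → ∂Σjacobi (suc n) ≈ -ₛ (xPoch n ⊛ xPoch (suc n))
  ∂Σjacobi-suc≈ zero = begin
      ∂Σjacobi 1
    ≈⟨ ∂Σjacobi-suc 0 ⟩
      α 0 ⊛ (∂Σjacobi 0 +ₛ Σjacobi 0) +ₛ β 0 ⊛ ((∂Σjacobi 0 +ₛ Σjacobi 0) +ₛ Σjacobi 0) +ₛ γ 0 ⊛ ∂Σjacobi 0
    ≈⟨ +ₛ-cong (+ₛ-cong (⊛-congˡ (α 0) (+ₛ-cong ∂Σjacobi-zero Σjacobi-zero))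
                        (⊛-cong (-ₛ-cong x^0) (+ₛ-cong (+ₛ-cong ∂Σjacobi-zero Σjacobi-zero) Σjacobi-zero)))
               (⊛-congˡ (γ 0) ∂Σjacobi-zero) ⟩
      α 0 ⊛ (ι 0ℤ +ₛ 1ₛ) +ₛ (-ₛ 1ₛ) ⊛ ((ι 0ℤ +ₛ 1ₛ) +ₛ 1ₛ) +ₛ γ 0 ⊛ ι 0ℤ
    ≈⟨ solve 1 (λ x → (con 1ℤ :+ x) :* (con 0ℤ :+ con 1ℤ) :+ (:- con 1ℤ) :* ((con 0ℤ :+ con 1ℤ) :+ con 1ℤ) :+ (:- x) :* con 0ℤ
                      := :- (con 1ℤ :* ((con 1ℤ :- x) :* con 1ℤ))) ≈-refl (x^ 1) ⟩
      -ₛ (1ₛ ⊛ ((1ₛ -ₛ x^ 1) ⊛ 1ₛ))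
    ≈⟨ -ₛ-cong (⊛-cong (≈-sym one≈1ₛ) (⊛-congˡ (1ₛ -ₛ x^ 1) (≈-sym one≈1ₛ))) ⟩
      -ₛ (xPoch 0 ⊛ xPoch 1) ∎
    where open ≈-Reasoning
  ∂Σjacobi-suc≈ (suc n) = begin
      ∂Σjacobi (suc (suc n))
    ≈⟨ ∂Σjacobi-suc (suc n) ⟩
      α (suc n) ⊛ (∂Σjacobi (suc n) +ₛ Σjacobi (suc n)) +ₛ β (suc n) ⊛ ((∂Σjacobi (suc n) +ₛ Σjacobi (suc n)) +ₛ Σjacobi (suc n))
        +ₛ γ (suc n) ⊛ ∂Σjacobi (suc n)
    ≈⟨ +ₛ-cong (+ₛ-cong (⊛-cong α≈ (+ₛ-cong IH (Σjacobi-suc≈0 n)))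
                        (⊛-congˡ (β (suc n)) (+ₛ-cong (+ₛ-cong IH (Σjacobi-suc≈0 n)) (Σjacobi-suc≈0 n))))
               (⊛-congˡ (γ (suc n)) IH) ⟩
      (1ₛ +ₛ x₁ ⊛ x₂) ⊛ (-ₛ (p ⊛ ((1ₛ -ₛ x₁) ⊛ p)) +ₛ ι 0ℤ)
        +ₛ (-ₛ x₁) ⊛ ((-ₛ (p ⊛ ((1ₛ -ₛ x₁) ⊛ p)) +ₛ ι 0ℤ) +ₛ ι 0ℤ)
        +ₛ (-ₛ x₂) ⊛ (-ₛ (p ⊛ ((1ₛ -ₛ x₁) ⊛ p)))
    ≈⟨ solve 3 (λ a b p → let P = :- (p :* ((con 1ℤ :- a) :* p)) in
               (con 1ℤ :+ a :* b) :* (P :+ con 0ℤ) :+ (:- a) :* ((P :+ con 0ℤ) :+ con 0ℤ) :+ (:- b) :* P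
               := :- (((con 1ℤ :- a) :* p) :* ((con 1ℤ :- b) :* ((con 1ℤ :- a) :* p)))) ≈-refl x₁ x₂ p ⟩
      -ₛ (xPoch (suc n) ⊛ xPoch (suc (suc n))) ∎
    where
    open ≈-Reasoning
    IH = ∂Σjacobi-suc≈ n
    p  = xPoch n
    x₁ = x^ (suc n)
    x₂ = x^ (suc (suc n))
    α≈ : α (suc n) ≈ 1ₛ +ₛ x₁ ⊛ x₂
    α≈ = +ₛ-congˡ 1ₛ (≈-sym (≈-trans (x^-+ (suc n) (suc (suc n))) (x^-≡ (suc+suc-suc≡suc-double n))))

  xPoch⊛qbinom≋1 : ∀ M m → xPoch m ⊛ qbinom M m ≋⟨ suc M ∸ m ⟩ 1ₛ
  xPoch⊛qbinom≋1 M       zero    = ≈⇒≋ (≈-trans (⊛-identityˡ one) one≈1ₛ)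
  xPoch⊛qbinom≋1 zero    (suc m) = mk≋ λ d d<0 → ⊥-elim (ℕP.n≮0 (subst (d <_) (ℕP.0∸n≡0 m) d<0))
  xPoch⊛qbinom≋1 (suc M) (suc m) =
    ≋-trans (≈⇒≋ split)
      (≋-trans (≋-+ (≋-⊛ (≋-refl {f = 1ₛ -ₛ x₁}) (xPoch⊛qbinom≋1 M m))
                    (≋-weaken precision (≋-q^⊛ (s ℕ.* suc m) (xPoch⊛qbinom≋1 M (suc m)))))
               (≈⇒≋ (solve 1 (λ x → (con 1ℤ :- x) :* con 1ℤ :+ x :* con 1ℤ := con 1ℤ) ≈-refl x₁)))
    where
    x₁ = x^ (suc m)
    split : xPoch (suc m) ⊛ qbinom (suc M) (suc m) ≈ (1ₛ -ₛ x₁) ⊛ (xPoch m ⊛ qbinom M m) +ₛ x₁ ⊛ (xPoch (suc m) ⊛ qbinom M (suc m))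
    split = solve 4 (λ x p a b → ((con 1ℤ :- x) :* p) :* (a :+ x :* b) := (con 1ℤ :- x) :* (p :* a) :+ x :* (((con 1ℤ :- x) :* p) :* b))
                    ≈-refl x₁ (xPoch m) (qbinom M m) (qbinom M (suc m))
    precision : suc M ∸ m ≤ s ℕ.* suc m ℕ.+ (M ∸ m)
    precision = ℕP.≤-trans (1+a∸b≤1+[a∸b] M m) (ℕP.+-monoˡ-≤ (M ∸ m) (ℕP.≤-trans (s≤s z≤n) (ℕP.m≤n*m (suc m) s)))
      where
      1+a∸b≤1+[a∸b] : ∀ a b → suc a ∸ b ≤ suc (a ∸ b)
      1+a∸b≤1+[a∸b] a       zero    = ℕP.≤-refl
      1+a∸b≤1+[a∸b] zero    (suc b) = ℕP.≤-trans (ℕP.≤-reflexive (ℕP.0∸n≡0 b)) z≤n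
      1+a∸b≤1+[a∸b] (suc a) (suc b) = 1+a∸b≤1+[a∸b] a b

  xPoch-suc≋ : ∀ N → xPoch (suc N) ≋⟨ suc N ⟩ xPoch N
  xPoch-suc≋ N =
    ≋-trans (≈⇒≋ (solve 2 (λ x p → (con 1ℤ :- x) :* p := p :+ (:- (x :* p))) ≈-refl (x^ (suc N)) (xPoch N)))
      (≋-trans (≋-+ (≋-refl {f = xPoch N}) (≋-neg (≋-weaken (ℕP.m≤n*m (suc N) s) (q^⊛≋0 (s ℕ.* suc N) (xPoch N)))))
               (≈⇒≋ (ext λ d → ℤP.+-identityʳ (xPoch N d))))

  xPoch-stable : ∀ m N → m ≤ N → xPoch N ≋⟨ suc m ⟩ xPoch m
  xPoch-stable m zero    z≤n = ≋-refl
  xPoch-stable m (suc N) m≤1+N with ℕP.m≤n⇒m<n∨m≡n m≤1+N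
  ... | inj₁ (s≤s m≤N) = ≋-trans (≋-weaken (s≤s m≤N) (xPoch-suc≋ N)) (xPoch-stable m N m≤N)
  ... | inj₂ refl      = ≋-refl

  qbinom⊛xPoch≋1 : ∀ N i → i < width (suc N) → qbinom (double (suc N)) i ⊛ xPoch N ≋⟨ suc N ∸ s ℕ.* θ i (suc N) ⟩ 1ₛ
  qbinom⊛xPoch≋1 N i i<w =
    ≋-trans (≋-⊛ (≋-refl {f = qbinom M i}) xPochN≋xPochi)
      (≋-trans (≈⇒≋ (⊛-comm (qbinom M i) (xPoch i))) (≋-weaken L≤1+M∸i (xPoch⊛qbinom≋1 M i)))
    where
    M  = double (suc N)
    t  = θ i (suc N)
    st = s ℕ.* t
    L  = suc N ∸ st
    t≤st : t ≤ st
    t≤st = ℕP.m≤n*m t s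
    xPochN≋xPochi : xPoch N ≋⟨ L ⟩ xPoch i
    xPochN≋xPochi with i ℕP.≤? N
    ... | yes i≤N = ≋-weaken (ℕP.m≤n+o⇒m∸n≤o (suc N) st
                               (ℕP.≤-trans (n≤θ+i i (suc N) (ℕP.m≤n⇒m≤1+n i≤N)) (ℕP.+-mono-≤ t≤st (ℕP.n≤1+n i))))
                             (xPoch-stable i N i≤N)
    ... | no i≰N  = ≋-weaken (ℕP.m∸n≤m (suc N) st) (≋-sym (xPoch-stable N i (ℕP.<⇒≤ (ℕP.≰⇒> i≰N))))
    L≤1+M∸i : L ≤ suc M ∸ i
    L≤1+M∸i with i ℕP.≤? N
    ... | yes i≤N = ℕP.≤-trans (ℕP.m∸n≤m (suc N) st) (ℕP.m+n≤o⇒m≤o∸n (suc N)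
                      (ℕP.≤-trans (ℕP.+-monoʳ-≤ (suc N) i≤N) (ℕP.≤-trans (ℕP.≤-reflexive (cong suc (sym (double≡+ N)))) (ℕP.m≤n+m _ 2))))
    ... | no i≰N  = ℕP.m≤n+o⇒m∸n≤o (suc N) st (ℕP.+-cancelʳ-≤ i (suc N) (st ℕ.+ (suc M ∸ i)) (begin
        suc N ℕ.+ i
      ≤⟨ ℕP.+-monoʳ-≤ (suc N) (i≤θ+1+n i (suc N) (ℕP.≰⇒> i≰N)) ⟩
        suc N ℕ.+ (t ℕ.+ suc (suc N))
      ≡⟨ x∙yz≈y∙xz (suc N) t (suc (suc N)) ⟩
        t ℕ.+ (suc N ℕ.+ suc (suc N))
      ≡⟨ cong (t ℕ.+_) (suc+suc-suc≡suc-double N) ⟩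
        t ℕ.+ suc M
      ≤⟨ ℕP.+-monoˡ-≤ (suc M) t≤st ⟩
        st ℕ.+ suc M
      ≡⟨ cong (st ℕ.+_) (sym (ℕP.m∸n+n≡m (ℕP.<⇒≤ i<w))) ⟩
        st ℕ.+ ((suc M ∸ i) ℕ.+ i)
      ≡⟨ sym (ℕP.+-assoc st (suc M ∸ i) i) ⟩
        st ℕ.+ (suc M ∸ i) ℕ.+ i ∎))
      where open ℕP.≤-Reasoning

  jacobiSeries : ℕ → Series
  jacobiSeries n = Σₛ (width n) (λ i → ι (+ i) ⊛ (ι (sign (i ℕ.+ n)) ⊛ x^ (θ i n)))

  ∂Σjacobi⊛xPoch≋jacobiSeries : ∀ N → ∂Σjacobi (suc N) ⊛ xPoch N ≋⟨ suc N ⟩ jacobiSeries (suc N)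
  ∂Σjacobi⊛xPoch≋jacobiSeries N = ≋-trans (≈⇒≋ distribute) (≋-Σₛ R (λ i i<R →
    ≋-⊛ (≋-refl {f = ι (+ i)}) (≋-⊛ (≋-refl {f = ι (sign (i ℕ.+ suc N))}) (limit i i<R))))
    where
    R = width (suc N)
    M = double (suc N)
    distribute : ∂Σjacobi (suc N) ⊛ xPoch N ≈
      Σₛ R (λ i → ι (+ i) ⊛ (ι (sign (i ℕ.+ suc N)) ⊛ (x^ (θ i (suc N)) ⊛ (qbinom M i ⊛ xPoch N))))
    distribute = ≈-trans (⊛-comm (∂Σjacobi (suc N)) (xPoch N)) (≈-trans (⊛-Σₛ R (xPoch N) (λ i → ι (+ i) ⊛ jacobiTerm (suc N) i))
      (Σₛ-cong R (λ i _ → solve 5 (λ p c σ t b → p :* (c :* (σ :* (t :* b))) := c :* (σ :* (t :* (b :* p))))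
                                  ≈-refl (xPoch N) (ι (+ i)) (ι (sign (i ℕ.+ suc N))) (x^ (θ i (suc N))) (qbinom M i))))
    limit : ∀ i → i < R → x^ (θ i (suc N)) ⊛ (qbinom M i ⊛ xPoch N) ≋⟨ suc N ⟩ x^ (θ i (suc N))
    limit i i<R = ≋-trans (≋-weaken (ℕP.m≤n+m∸n (suc N) (s ℕ.* θ i (suc N))) (≋-q^⊛ (s ℕ.* θ i (suc N)) (qbinom⊛xPoch≋1 N i i<R)))
                          (≈⇒≋ (≈-trans (⊛-comm (x^ (θ i (suc N))) 1ₛ) (1ₛ-⊛ (x^ (θ i (suc N))))))

  xPoch-cube : ∀ N → xPoch N ⊛ (xPoch N ⊛ xPoch N) ≋⟨ suc N ⟩ -ₛ jacobiSeries (suc N)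
  xPoch-cube N =
    ≋-trans (≈⇒≋ (solve 1 (λ p → p :* (p :* p) := :- ((:- (p :* p)) :* p)) ≈-refl (xPoch N)))
      (≋-trans (≋-neg (≋-⊛ (≋-neg (≋-⊛ (≋-refl {f = xPoch N}) (≋-sym (xPoch-suc≋ N)))) (≋-refl {f = xPoch N})))
        (≋-trans (≋-neg (≈⇒≋ (⊛-congʳ (xPoch N) (≈-sym (∂Σjacobi-suc≈ N)))))
                 (≋-neg (∂Σjacobi⊛xPoch≋jacobiSeries N))))

  jacobiWeight : ℕ → ℕ → ℕ → ℤ
  jacobiWeight n d i = + i * (sign (i ℕ.+ n) * (x^ (θ i n)) d)

  jacobiSeries-coeff : ∀ n d → jacobiSeries n d ≡ sumBelow (width n) (jacobiWeight n d)
  jacobiSeries-coeff n d = sumBelow-cong (width n) (λ i _ →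
    trans (ι-⊛ (+ i) (ι (sign (i ℕ.+ n)) ⊛ x^ (θ i n)) d) (cong (λ t → + i * t) (ι-⊛ (sign (i ℕ.+ n)) (x^ (θ i n)) d)))

  -- The terms i and 2n + 1 - i share the exponent θ and have opposite signs.
  jacobiWeight-pair : ∀ n d a b → a ℕ.+ b ≡ suc (n ℕ.+ n) → (d ≡ s ℕ.* θ a n → Residue≥2 (θ a n)) →
    + 5 ∣ jacobiWeight n d a + jacobiWeight n d b
  jacobiWeight-pair n d a b a+b≡2n+1 residue = subst (+ 5 ∣_) (sym combine) 5∣product
    where
    σ = sign (a ℕ.+ n)
    m = (x^ (θ a n)) d
    b≡ : + b ≡ (1ℤ + (+ n + + n)) - + a
    b≡ = trans (sym (cancel (+ a) (+ b))) (cong (λ t → + t - + a) a+b≡2n+1)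
      where cancel : ∀ a b → (a + b) - a ≡ b
            cancel = ℤ-Solver.solve-∀
    sign-b : sign (b ℕ.+ n) ≡ - σ
    sign-b = sign-odd (a ℕ.+ n) (b ℕ.+ n) (n ℕ.+ n)
      (trans (regroup a b n) (trans (cong (ℕ._+ (n ℕ.+ n)) a+b≡2n+1) (cong suc (sym (double≡+ (n ℕ.+ n))))))
      where regroup : ∀ a b n → (a ℕ.+ n) ℕ.+ (b ℕ.+ n) ≡ (a ℕ.+ b) ℕ.+ (n ℕ.+ n)
            regroup = ℕ-Solver.solve-∀
    combine : jacobiWeight n d a + jacobiWeight n d b ≡ (+ a * + 2 - (+ n * + 2 + 1ℤ)) * (σ * m)
    combine = begin
        + a * (σ * m) + + b * (sign (b ℕ.+ n) * (x^ (θ b n)) d)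
      ≡⟨ cong₂ (λ u v → + a * (σ * m) + u * (v * (x^ (θ b n)) d)) b≡ sign-b ⟩
        + a * (σ * m) + ((1ℤ + (+ n + + n)) - + a) * (- σ * (x^ (θ b n)) d)
      ≡⟨ cong (λ t → + a * (σ * m) + ((1ℤ + (+ n + + n)) - + a) * (- σ * (x^ t) d)) (θ-reflect a b n a+b≡2n+1) ⟩
        + a * (σ * m) + ((1ℤ + (+ n + + n)) - + a) * (- σ * m)
      ≡⟨ collect (+ a) (+ n) σ m ⟩
        (+ a * + 2 - (+ n * + 2 + 1ℤ)) * (σ * m) ∎
      where
      open ≡-Reasoning
      collect : ∀ a n σ m → a * (σ * m) + ((1ℤ + (n + n)) - a) * (- σ * m) ≡ (a * + 2 - (n * + 2 + 1ℤ)) * (σ * m)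
      collect = ℤ-Solver.solve-∀
    5∣product : + 5 ∣ (+ a * + 2 - (+ n * + 2 + 1ℤ)) * (σ * m)
    5∣product with d ℕ.≟ s ℕ.* θ a n
    ... | yes d≡ = ∣m⇒∣m*n (σ * m) (θ-mod5 a n (residue d≡))
    ... | no d≢  = ∣n⇒∣m*n (+ a * + 2 - (+ n * + 2 + 1ℤ)) (∣n⇒∣m*n σ (subst (+ 5 ∣_) (sym (q^-off (s ℕ.* θ a n) d d≢)) 5∣0))

  jacobiSeries-5∣ : ∀ n d → (∀ e → d ≡ s ℕ.* e → Residue≥2 e) → + 5 ∣ jacobiSeries n d
  jacobiSeries-5∣ n d residue = subst (+ 5 ∣_) (sym (trans (jacobiSeries-coeff n d) drop-zero))
    (subst (+ 5 ∣_) (sym (ℤP.+-identityˡ S)) (5∣-half S (subst (+ 5 ∣_) pair-up (5∣-sumBelow K pairs))))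
    where
    K = double n
    w = jacobiWeight n d
    S = sumBelow K (w ∘ suc)
    drop-zero : sumBelow (suc K) w ≡ 0ℤ + S
    drop-zero = trans (sumBelow-head K w) (cong (_+ S) (ℤP.*-zeroˡ (sign n * (x^ (θ 0 n)) d)))
    pair-up : sumBelow K (λ i → w (suc i) + w (suc (K ∸ suc i))) ≡ S + S
    pair-up = trans (sumBelow-+ K (w ∘ suc) (λ i → w (suc (K ∸ suc i)))) (cong (λ t → S + t) (sym (sumBelow-reverse K (w ∘ suc))))
    pairs : ∀ i → i < K → + 5 ∣ w (suc i) + w (suc (K ∸ suc i))
    pairs i i<K = jacobiWeight-pair n d (suc i) (suc (K ∸ suc i))
      (trans (ℕP.+-suc (suc i) (K ∸ suc i)) (cong suc (trans (ℕP.m+[n∸m]≡n i<K) (double≡+ n))))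
      (residue (θ (suc i) n))

module EulerProducts where

  open PowerSeries
  open Congruence5
  open import Data.Nat as ℕ using (ℕ; zero; suc; _∸_; _<_)
  import Data.Nat.Properties as ℕP
  import Data.Nat.Divisibility as ℕD
  open import Data.Integer using (+_; -_; _+_; 0ℤ; 1ℤ)
  import Data.Integer.Properties as ℤP
  open import Data.Empty using (⊥-elim)
  open import Function using (_∘_)
  open import Relation.Binary.PropositionalEquality
  open import Relation.Nullary using (yes; no)
  open SeriesSolver using (solve; _:=_; _:+_; _:*_; _:-_; :-_; con)

  oneMinusQ^≈ : ∀ k → oneMinusQ^ (suc k) ≈ one -ₛ q^ (suc k)
  oneMinusQ^≈ k = ext coeff
    where
    coeff : ∀ d → oneMinusQ^ (suc k) d ≡ (one -ₛ q^ (suc k)) d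
    coeff zero = refl
    coeff (suc d) with suc d ℕ.≟ suc k
    ... | yes refl = cong (λ z → 0ℤ + - z) (sym (q^-diag d))
    ... | no d≢k   = sym (cong (λ z → 0ℤ + - z) (q^-off k d (d≢k ∘ cong suc)))

  invOneMinusQ^-< : ∀ K d → d < K → invOneMinusQ^ K d ≡ one d
  invOneMinusQ^-< K zero _ with K ℕD.∣? 0
  ... | yes _   = refl
  ... | no K∤0 = ⊥-elim (K∤0 (ℕD.divides 0 refl))
  invOneMinusQ^-< K (suc d) d<K with K ℕD.∣? suc d
  ... | yes K∣d = ⊥-elim (ℕP.<⇒≱ d<K (ℕD.∣⇒≤ K∣d))
  ... | no _    = refl

  invOneMinusQ^-periodic : ∀ K d → invOneMinusQ^ K (K ℕ.+ d) ≡ invOneMinusQ^ K d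
  invOneMinusQ^-periodic K d with K ℕD.∣? (K ℕ.+ d) | K ℕD.∣? d
  ... | yes _   | yes _   = refl
  ... | no _    | no _    = refl
  ... | yes K∣K+d | no K∤d  = ⊥-elim (K∤d (ℕD.∣m+n∣m⇒∣n K∣K+d ℕD.∣-refl))
  ... | no K∤K+d  | yes K∣d = ⊥-elim (K∤K+d (ℕD.∣m∣n⇒∣m+n ℕD.∣-refl K∣d))

  invOneMinusQ^-telescopes : ∀ k d → invOneMinusQ^ (suc k) d + - shiftBy (suc k) (invOneMinusQ^ (suc k)) d ≡ one d
  invOneMinusQ^-telescopes k d with d ℕ.<? suc k
  ... | yes d<K = trans (cong (λ z → u d + - z) (shiftBy-< (suc k) u d d<K)) (trans (ℤP.+-identityʳ (u d)) (invOneMinusQ^-< (suc k) d d<K))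
    where u = invOneMinusQ^ (suc k)
  ... | no d≮K  = begin
      u d + - shiftBy K u d
    ≡⟨ cong (λ z → u z + - shiftBy K u z) (sym K+d′≡d) ⟩
      u (K ℕ.+ d′) + - shiftBy K u (K ℕ.+ d′)
    ≡⟨ cong₂ (λ a b → a + - b) (invOneMinusQ^-periodic K d′) (shiftBy-+ K u d′) ⟩
      u d′ + - u d′
    ≡⟨ ℤP.+-inverseʳ (u d′) ⟩
      0ℤ
    ≡⟨ cong one K+d′≡d ⟩
      one d ∎
    where
    open ≡-Reasoning
    K  = suc k
    u  = invOneMinusQ^ K
    d′ = d ∸ K
    K+d′≡d : K ℕ.+ d′ ≡ d
    K+d′≡d = ℕP.m+[n∸m]≡n (ℕP.≮⇒≥ d≮K)

  invOneMinusQ^-inverse : ∀ k → invOneMinusQ^ (suc k) ⊛ oneMinusQ^ (suc k) ≈ one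
  invOneMinusQ^-inverse k = begin
      u ⊛ oneMinusQ^ K
    ≈⟨ ⊛-congˡ u (oneMinusQ^≈ k) ⟩
      u ⊛ (one -ₛ q^ K)
    ≈⟨ solve 3 (λ u o x → u :* (o :- x) := u :* o :- x :* u) ≈-refl u one (q^ K) ⟩
      u ⊛ one -ₛ q^ K ⊛ u
    ≈⟨ +ₛ-cong (⊛-identityʳ u) (-ₛ-cong (q^-⊛ K u)) ⟩
      u -ₛ shiftBy K u
    ≈⟨ ext (invOneMinusQ^-telescopes k) ⟩
      one ∎
    where
    open ≈-Reasoning
    K = suc k
    u = invOneMinusQ^ K

  prodTo-cong : ∀ N {F G} → (∀ k → F (suc k) ≈ G (suc k)) → prodTo N F ≈ prodTo N G
  prodTo-cong zero    eq = ≈-refl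
  prodTo-cong (suc N) eq = ⊛-cong (eq N) (prodTo-cong N eq)

  prodTo-≋ : ∀ {L} N {F G} → (∀ k → F (suc k) ≋⟨ L ⟩ G (suc k)) → prodTo N F ≋⟨ L ⟩ prodTo N G
  prodTo-≋ zero    eq = ≋-refl
  prodTo-≋ (suc N) eq = ≋-⊛ (eq N) (prodTo-≋ N eq)

  prodTo-one : ∀ N → prodTo N (λ _ → one) ≈ one
  prodTo-one zero    = ≈-refl
  prodTo-one (suc N) = ≈-trans (⊛-identityˡ _) (prodTo-one N)

  prodTo-⊛ : ∀ N F G → prodTo N F ⊛ prodTo N G ≈ prodTo N (λ k → F k ⊛ G k)
  prodTo-⊛ zero    F G = ⊛-identityˡ one
  prodTo-⊛ (suc N) F G = ≈-trans
    (solve 4 (λ a b c d → (a :* b) :* (c :* d) := (a :* c) :* (b :* d)) ≈-refl (F (suc N)) (prodTo N F) (G (suc N)) (prodTo N G))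
    (⊛-congˡ (F (suc N) ⊛ G (suc N)) (prodTo-⊛ N F G))

  ^ₛ-cong : ∀ m {f g} → f ≈ g → f ^ₛ m ≈ g ^ₛ m
  ^ₛ-cong zero    eq = ≈-refl
  ^ₛ-cong (suc m) eq = ⊛-cong eq (^ₛ-cong m eq)

  ^ₛ-distrib-⊛ : ∀ m f g → (f ⊛ g) ^ₛ m ≈ (f ^ₛ m) ⊛ (g ^ₛ m)
  ^ₛ-distrib-⊛ zero    f g = ≈-sym (⊛-identityˡ one)
  ^ₛ-distrib-⊛ (suc m) f g = ≈-trans (⊛-congˡ (f ⊛ g) (^ₛ-distrib-⊛ m f g))
    (solve 4 (λ a b c d → (a :* b) :* (c :* d) := (a :* c) :* (b :* d)) ≈-refl f g (f ^ₛ m) (g ^ₛ m))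

  one-^ₛ : ∀ m → one ^ₛ m ≈ one
  one-^ₛ zero    = ≈-refl
  one-^ₛ (suc m) = ≈-trans (⊛-identityˡ _) (one-^ₛ m)

  prodTo-^ₛ : ∀ m N F → prodTo N F ^ₛ m ≈ prodTo N (λ k → F k ^ₛ m)
  prodTo-^ₛ zero    N F = ≈-sym (prodTo-one N)
  prodTo-^ₛ (suc m) N F = ≈-trans (⊛-congˡ (prodTo N F) (prodTo-^ₛ m N F)) (prodTo-⊛ N F (λ k → F k ^ₛ m))

  q^-^ₛ : ∀ m e → (q^ e) ^ₛ m ≈ q^ (m ℕ.* e)
  q^-^ₛ zero    e = ≈-refl
  q^-^ₛ (suc m) e = ≈-trans (⊛-congˡ (q^ e) (q^-^ₛ m e)) (q^-+ e (m ℕ.* e))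

  ^ₛ-4 : ∀ f → f ^ₛ 4 ≈ f ⊛ (f ⊛ (f ⊛ f))
  ^ₛ-4 f = ⊛-congˡ f (⊛-congˡ f (⊛-congˡ f (⊛-identityʳ f)))

  ^ₛ-5 : ∀ f → f ^ₛ 5 ≈ f ⊛ (f ⊛ (f ⊛ (f ⊛ f)))
  ^ₛ-5 f = ⊛-congˡ f (^ₛ-4 f)

  factor-⊛ : ∀ k → factor (suc k) ⊛ (oneMinusQ^ (suc k) ^ₛ 5) ≈ oneMinusQ^ (2 ℕ.* suc k) ^ₛ 4
  factor-⊛ k = begin
      (a ⊛ (u ^ₛ 5)) ⊛ (oneMinusQ^ (suc k) ^ₛ 5)
    ≈⟨ ⊛-assoc a (u ^ₛ 5) (oneMinusQ^ (suc k) ^ₛ 5) ⟩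
      a ⊛ ((u ^ₛ 5) ⊛ (oneMinusQ^ (suc k) ^ₛ 5))
    ≈⟨ ⊛-congˡ a (≈-sym (^ₛ-distrib-⊛ 5 u (oneMinusQ^ (suc k)))) ⟩
      a ⊛ ((u ⊛ oneMinusQ^ (suc k)) ^ₛ 5)
    ≈⟨ ⊛-congˡ a (≈-trans (^ₛ-cong 5 (invOneMinusQ^-inverse k)) (one-^ₛ 5)) ⟩
      a ⊛ one
    ≈⟨ ⊛-identityʳ a ⟩
      a ∎
    where
    open ≈-Reasoning
    a = oneMinusQ^ (2 ℕ.* suc k) ^ₛ 4
    u = invOneMinusQ^ (suc k)

  euler₁ : ℕ → Series
  euler₁ N = prodTo N oneMinusQ^

  euler : ℕ → ℕ → Series
  euler c N = prodTo N (λ k → oneMinusQ^ (c ℕ.* k))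

  prodTo-factor : ∀ N → prodTo N factor ⊛ (euler₁ N ^ₛ 5) ≈ euler 2 N ^ₛ 4
  prodTo-factor N = begin
      prodTo N factor ⊛ (euler₁ N ^ₛ 5)
    ≈⟨ ⊛-congˡ (prodTo N factor) (prodTo-^ₛ 5 N oneMinusQ^) ⟩
      prodTo N factor ⊛ prodTo N (λ k → oneMinusQ^ k ^ₛ 5)
    ≈⟨ prodTo-⊛ N factor (λ k → oneMinusQ^ k ^ₛ 5) ⟩
      prodTo N (λ k → factor k ⊛ (oneMinusQ^ k ^ₛ 5))
    ≈⟨ prodTo-cong N factor-⊛ ⟩
      prodTo N (λ k → oneMinusQ^ (2 ℕ.* k) ^ₛ 4)
    ≈⟨ ≈-sym (prodTo-^ₛ 4 N (λ k → oneMinusQ^ (2 ℕ.* k))) ⟩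
      euler 2 N ^ₛ 4 ∎
    where open ≈-Reasoning

  -- (1 - x)^5 = (1 - x^5) + 5 (- x + 2 x^2 - 2 x^3 + x^4).
  frobenius : ∀ {L} e → (one -ₛ q^ e) ^ₛ 5 ≋⟨ L ⟩ one -ₛ q^ (5 ℕ.* e)
  frobenius e = ≋-trans (≈⇒≋ binomial) (≋-trans (≋-+ (≋-refl {f = 1ₛ -ₛ x⁵}) (ι5⊛≋0 middle)) (≈⇒≋ fifth-power))
    where
    x  = q^ e
    x⁵ = x ⊛ (x ⊛ (x ⊛ (x ⊛ x)))
    middle = ι (- 1ℤ) ⊛ x +ₛ ι (+ 2) ⊛ (x ⊛ x) -ₛ ι (+ 2) ⊛ (x ⊛ (x ⊛ x)) +ₛ x ⊛ (x ⊛ (x ⊛ x))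
    binomial : (one -ₛ x) ^ₛ 5 ≈ (1ₛ -ₛ x⁵) +ₛ ι (+ 5) ⊛ middle
    binomial = ≈-trans (^ₛ-5 (one -ₛ x)) (≈-trans (⊛-cong one-x (⊛-cong one-x (⊛-cong one-x (⊛-cong one-x one-x))))
      (solve 1 (λ x → (con 1ℤ :- x) :* ((con 1ℤ :- x) :* ((con 1ℤ :- x) :* ((con 1ℤ :- x) :* (con 1ℤ :- x))))
                      := (con 1ℤ :- x :* (x :* (x :* (x :* x))))
                         :+ con (+ 5) :* (con (- 1ℤ) :* x :+ con (+ 2) :* (x :* x) :- con (+ 2) :* (x :* (x :* x)) :+ x :* (x :* (x :* x))))
             ≈-refl x))
      where one-x = +ₛ-congʳ (-ₛ x) one≈1ₛ
    fifth-power : (1ₛ -ₛ x⁵) +ₛ 0ₛ ≈ one -ₛ q^ (5 ℕ.* e)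
    fifth-power = ≈-trans (+ₛ-identityʳ _) (+ₛ-cong (≈-sym one≈1ₛ) (-ₛ-cong (≈-trans (≈-sym (^ₛ-5 x)) (q^-^ₛ 5 e))))

  oneMinusQ^-frobenius : ∀ {L} k → oneMinusQ^ (suc k) ^ₛ 5 ≋⟨ L ⟩ oneMinusQ^ (5 ℕ.* suc k)
  oneMinusQ^-frobenius k = ≋-trans (≈⇒≋ (^ₛ-cong 5 (oneMinusQ^≈ k)))
    (≋-trans (frobenius (suc k)) (≈⇒≋ (≈-sym (oneMinusQ^≈ (k ℕ.+ 4 ℕ.* suc k)))))

  euler₁-frobenius : ∀ {L} N → euler₁ N ^ₛ 5 ≋⟨ L ⟩ euler 5 N
  euler₁-frobenius N = ≋-trans (≈⇒≋ (prodTo-^ₛ 5 N oneMinusQ^)) (prodTo-≋ N oneMinusQ^-frobenius)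

  euler₂-frobenius : ∀ {L} N → euler 2 N ^ₛ 5 ≋⟨ L ⟩ euler 10 N
  euler₂-frobenius N = ≋-trans (≈⇒≋ (prodTo-^ₛ 5 N (λ k → oneMinusQ^ (2 ℕ.* k))))
    (prodTo-≋ N (λ k → ≋-trans (oneMinusQ^-frobenius (k ℕ.+ (suc k ℕ.+ 0)))
                               (≈⇒≋ (ext λ d → cong (λ c → oneMinusQ^ c d) (sym (ℕP.*-assoc 5 2 (suc k)))))))

module ResidueSupport where

  open PowerSeries
  open Congruence5
  open import Data.Nat as ℕ using (ℕ; zero; suc; _∸_; _≤_; _<_; s≤s; _%_; _≡ᵇ_)
  import Data.Nat.Properties as ℕP
  open import Data.Nat.DivMod using (%-distribˡ-+; m%n%n≡m%n; m%n<n)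
  open import Data.Integer as ℤ using (+_; _+_; _*_; 1ℤ)
  open import Data.Integer.Divisibility.Signed using (_∣_; ∣n⇒∣m*n; ∣m⇒∣m*n; ∣m⇒∣-m; ∣m∣n⇒∣m+n)
  open import Data.Bool using (Bool; true; false; _∨_; _∧_; not; T)
  import Data.Integer.Properties as ℤP
  open import Data.Integer.Tactic.RingSolver as ℤ-Solver using ()
  open import Data.Nat.Induction using (<-rec)
  open import Data.Empty using (⊥-elim)
  open import Relation.Binary.PropositionalEquality

  true≢false : true ≢ false
  true≢false ()

  record Supported (L : ℕ) (S : ℕ → Bool) (f : Series) : Set where
    constructor supported
    field vanishes : ∀ d → d < L → S (d % 5) ≡ false → + 5 ∣ f d
  open Supported public

  Supported-≋ : ∀ {L S f g} → f ≋⟨ L ⟩ g → Supported L S g → Supported L S f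
  Supported-≋ f≋g g-supp = supported λ d d<L d∉S → 5∣-≡₅ (coeff-≡₅ f≋g d d<L) (vanishes g-supp d d<L d∉S)

  _⊕_⊆_ : (ℕ → Bool) → (ℕ → Bool) → (ℕ → Bool) → Set
  S₁ ⊕ S₂ ⊆ S₃ = ∀ a b → S₁ (a % 5) ≡ true → S₂ (b % 5) ≡ true → S₃ ((a ℕ.+ b) % 5) ≡ true

  Supported-⊛ : ∀ {L S₁ S₂ S₃ f g} → Supported L S₁ f → Supported L S₂ g → S₁ ⊕ S₂ ⊆ S₃ → Supported L S₃ (f ⊛ g)
  Supported-⊛ {L} {S₁} {S₂} {S₃} {f} {g} f-supp g-supp closed = supported λ d d<L d∉S₃ → 5∣-sumTo d (term d d<L d∉S₃)
    where
    term : ∀ d → d < L → S₃ (d % 5) ≡ false → ∀ i → i ≤ d → + 5 ∣ f i * g (d ∸ i)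
    term d d<L d∉S₃ i i≤d with S₁ (i % 5) in i∈S₁ | S₂ ((d ∸ i) % 5) in d-i∈S₂
    ... | false | _     = ∣m⇒∣m*n (g (d ∸ i)) (vanishes f-supp i (ℕP.≤-<-trans i≤d d<L) i∈S₁)
    ... | true  | false = ∣n⇒∣m*n (f i) (vanishes g-supp (d ∸ i) (ℕP.≤-<-trans (ℕP.m∸n≤m d i) d<L) d-i∈S₂)
    ... | true  | true  = ⊥-elim (true≢false (trans (sym d∈S₃) d∉S₃))
      where d∈S₃ = subst (λ m → S₃ (m % 5) ≡ true) (ℕP.m+[n∸m]≡n i≤d) (closed i (d ∸ i) i∈S₁ d-i∈S₂)

  byResidue : ∀ {P : ℕ → Set} → P 0 → P 1 → P 2 → P 3 → P 4 → ∀ r → r < 5 → P r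
  byResidue p₀ p₁ p₂ p₃ p₄ 0 _ = p₀
  byResidue p₀ p₁ p₂ p₃ p₄ 1 _ = p₁
  byResidue p₀ p₁ p₂ p₃ p₄ 2 _ = p₂
  byResidue p₀ p₁ p₂ p₃ p₄ 3 _ = p₃
  byResidue p₀ p₁ p₂ p₃ p₄ 4 _ = p₄
  byResidue p₀ p₁ p₂ p₃ p₄ (suc (suc (suc (suc (suc _))))) (s≤s (s≤s (s≤s (s≤s (s≤s ())))))

  ⊕⊆-byTable : ∀ S₁ S₂ S₃ → (∀ r₁ → r₁ < 5 → ∀ r₂ → r₂ < 5 → not (S₁ r₁ ∧ S₂ r₂) ∨ S₃ ((r₁ ℕ.+ r₂) % 5) ≡ true) →
    S₁ ⊕ S₂ ⊆ S₃
  ⊕⊆-byTable S₁ S₂ S₃ table a b a∈S₁ b∈S₂ = subst (λ r → S₃ r ≡ true) (sym (%-distribˡ-+ a b 5))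
    (implication (table (a % 5) (m%n<n a 5) (b % 5) (m%n<n b 5)) a∈S₁ b∈S₂)
    where
    implication : ∀ {x y z} → not (x ∧ y) ∨ z ≡ true → x ≡ true → y ≡ true → z ≡ true
    implication {true} {true} x∧y⇒z refl refl = x∧y⇒z

  ≡0 ∈02 ∈024 : ℕ → Bool
  ≡0   r = r ≡ᵇ 0
  ∈02  r = (r ≡ᵇ 0) ∨ (r ≡ᵇ 2)
  ∈024 r = ∈02 r ∨ (r ≡ᵇ 4)

  ≢_ : ℕ → ℕ → Bool
  (≢ r) x = not (x ≡ᵇ r)

  ≡0⊕≡0⊆≡0 : ≡0 ⊕ ≡0 ⊆ ≡0
  ≡0⊕≡0⊆≡0 = ⊕⊆-byTable ≡0 ≡0 ≡0 (byResidue (byResidue refl refl refl refl refl) (byResidue refl refl refl refl refl)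
    (byResidue refl refl refl refl refl) (byResidue refl refl refl refl refl) (byResidue refl refl refl refl refl))

  ∈02⊕∈02⊆∈024 : ∈02 ⊕ ∈02 ⊆ ∈024
  ∈02⊕∈02⊆∈024 = ⊕⊆-byTable ∈02 ∈02 ∈024 (byResidue (byResidue refl refl refl refl refl) (byResidue refl refl refl refl refl)
    (byResidue refl refl refl refl refl) (byResidue refl refl refl refl refl) (byResidue refl refl refl refl refl))

  ∈02⊕∈024⊆≢3 : ∈02 ⊕ ∈024 ⊆ (≢ 3)
  ∈02⊕∈024⊆≢3 = ⊕⊆-byTable ∈02 ∈024 (≢ 3) (byResidue (byResidue refl refl refl refl refl) (byResidue refl refl refl refl refl)
    (byResidue refl refl refl refl refl) (byResidue refl refl refl refl refl) (byResidue refl refl refl refl refl))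

  ≢-self : ∀ r → (≢ r) r ≡ false
  ≢-self zero    = refl
  ≢-self (suc r) = ≢-self r

  ≢-false⇒≡ : ∀ r x → (≢ r) x ≡ false → x ≡ r
  ≢-false⇒≡ r x x≡r with x ≡ᵇ r in x≡ᵇr
  ... | true = ℕP.≡ᵇ⇒≡ x r (subst T (sym x≡ᵇr) _)

  ≡0-true⇒≡0 : ∀ x → ≡0 x ≡ true → x ≡ 0
  ≡0-true⇒≡0 zero _ = refl

  %5-∸ : ∀ d i → i ≤ d → (d ∸ i) % 5 ≡ 0 → i % 5 ≡ d % 5
  %5-∸ d i i≤d d-i≡0 = begin
      i % 5
    ≡⟨ sym (m%n%n≡m%n i 5) ⟩
      i % 5 % 5
    ≡⟨ cong (_% 5) (sym (ℕP.+-identityʳ (i % 5))) ⟩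
      ((i % 5) ℕ.+ 0) % 5
    ≡⟨ cong (λ m → (i % 5 ℕ.+ m) % 5) (sym d-i≡0) ⟩
      ((i % 5) ℕ.+ (d ∸ i) % 5) % 5
    ≡⟨ sym (%-distribˡ-+ i (d ∸ i) 5) ⟩
      (i ℕ.+ (d ∸ i)) % 5
    ≡⟨ cong (_% 5) (ℕP.m+[n∸m]≡n i≤d) ⟩
      d % 5 ∎
    where open ≡-Reasoning

  Supported-cancel : ∀ {L} r {a c} → Supported L ≡0 c → c 0 ≡ 1ℤ → Supported L (≢ r) (a ⊛ c) → Supported L (≢ r) a
  Supported-cancel {L} r {a} {c} c-supp c₀≡1 ac-supp = supported (<-rec P step)
    where
    P : ℕ → Set
    P d = d < L → (≢ r) (d % 5) ≡ false → + 5 ∣ a d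
    step : ∀ d → (∀ {i} → i < d → P i) → P d
    step zero    _  0<L 0≡r = subst (+ 5 ∣_) (trans (cong (a 0 *_) c₀≡1) (ℤP.*-identityʳ (a 0))) (vanishes ac-supp 0 0<L 0≡r)
    step (suc d) IH d<L d≡r = subst (+ 5 ∣_) solve-for-a (∣m∣n⇒∣m+n (vanishes ac-supp (suc d) d<L d≡r) (∣m⇒∣-m (5∣-sumTo d term)))
      where
      rest = sumTo d (λ i → a i * c (suc d ∸ i))
      solve-for-a : (a ⊛ c) (suc d) + ℤ.- rest ≡ a (suc d)
      solve-for-a = begin
          rest + a (suc d) * c (suc d ∸ suc d) + ℤ.- rest
        ≡⟨ cong (λ z → rest + a (suc d) * z + ℤ.- rest) (trans (cong c (ℕP.n∸n≡0 d)) c₀≡1) ⟩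
          rest + a (suc d) * 1ℤ + ℤ.- rest
        ≡⟨ cancel rest (a (suc d)) ⟩
          a (suc d) ∎
        where
        open ≡-Reasoning
        cancel : ∀ r a → r + a * 1ℤ + ℤ.- r ≡ a
        cancel = ℤ-Solver.solve-∀
      term : ∀ i → i ≤ d → + 5 ∣ a i * c (suc d ∸ i)
      term i i≤d with (≢ r) (i % 5) in i≢r | ≡0 ((suc d ∸ i) % 5) in d-i≡0
      ... | false | _     = ∣m⇒∣m*n (c (suc d ∸ i)) (IH (s≤s i≤d) (ℕP.<-trans (s≤s i≤d) d<L) i≢r)
      ... | true  | false = ∣n⇒∣m*n (a i) (vanishes c-supp (suc d ∸ i) (ℕP.≤-<-trans (ℕP.m∸n≤m (suc d) i) d<L) d-i≡0)
      ... | true  | true  = ⊥-elim (true≢false (trans (sym r≢r) (≢-self r)))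
        where
        i%5≡r : i % 5 ≡ r
        i%5≡r = trans (%5-∸ (suc d) i (ℕP.m≤n⇒m≤1+n i≤d) (≡0-true⇒≡0 _ d-i≡0)) (≢-false⇒≡ r (suc d % 5) d≡r)
        r≢r : (≢ r) r ≡ true
        r≢r = trans (cong (≢ r) (sym i%5≡r)) i≢r

module GeneratingFunction where

  open PowerSeries
  open Congruence5
  open Triangular using (Residue≥2)
  open EulerProducts
  open ResidueSupport
  open Jacobi 2 using (xPoch; xPoch-cube; jacobiSeries-5∣)
  open import Data.Nat as ℕ using (ℕ; zero; suc; _%_)
  open import Data.Nat.DivMod using (%-distribˡ-*)
  open import Data.Integer using (+_; _*_; 1ℤ)
  import Data.Integer.Properties as ℤP
  open import Data.Integer.Divisibility.Signed using (_∣_; ∣m⇒∣-m)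
  open import Data.Bool using (true; false)
  open import Data.Empty using (⊥-elim)
  open import Data.Product using (_,_)
  open import Relation.Binary.PropositionalEquality
  open import Relation.Nullary using (yes; no)
  open SeriesSolver using (solve; _:=_; _:*_)

  oneMinusQ^-supported : ∀ {L} c → c % 5 ≡ 0 → Supported L ≡0 (oneMinusQ^ c)
  oneMinusQ^-supported {L} c c≡0 = supported coeff
    where
    coeff : ∀ d → d ℕ.< L → ≡0 (d % 5) ≡ false → + 5 ∣ oneMinusQ^ c d
    coeff zero    _ ()
    coeff (suc d) _ d∉≡0 with suc d ℕ.≟ c
    ... | yes refl = ⊥-elim (true≢false (trans (sym (cong ≡0 c≡0)) d∉≡0))
    ... | no _     = 5∣0

  euler-supported : ∀ {L} c N → c % 5 ≡ 0 → Supported L ≡0 (euler c N)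
  euler-supported c zero    c≡0 = supported λ { zero _ () ; (suc d) _ _ → 5∣0 }
  euler-supported c (suc N) c≡0 = Supported-⊛ (oneMinusQ^-supported (c ℕ.* suc N) ck≡0) (euler-supported c N c≡0) ≡0⊕≡0⊆≡0
    where ck≡0 = trans (%-distribˡ-* c (suc N) 5) (cong (λ r → (r ℕ.* (suc N % 5)) % 5) c≡0)

  euler-zero : ∀ c N → euler c N 0 ≡ 1ℤ
  euler-zero c zero    = refl
  euler-zero c (suc N) = trans (ℤP.*-identityˡ (euler c N 0)) (euler-zero c N)

  euler₂≈xPoch : ∀ N → euler 2 N ≈ xPoch N
  euler₂≈xPoch N = prodTo-cong N (λ k → ≈-trans (oneMinusQ^≈ (k ℕ.+ (suc k ℕ.+ 0))) (+ₛ-congʳ (-ₛ q^ (2 ℕ.* suc k)) one≈1ₛ))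

  euler₂³ : ℕ → Series
  euler₂³ N = euler 2 N ⊛ (euler 2 N ⊛ euler 2 N)

  -- x ↦ 2x maps the triangular residues {0, 1} mod 5 to {0, 2}.
  euler₂³-supported : ∀ N → Supported (suc N) ∈02 (euler₂³ N)
  euler₂³-supported N = Supported-≋ (≋-trans (≈⇒≋ (⊛-cong (euler₂≈xPoch N) (⊛-cong (euler₂≈xPoch N) (euler₂≈xPoch N)))) (xPoch-cube N))
    (supported λ d _ d∉ → ∣m⇒∣-m (jacobiSeries-5∣ (suc N) d (residue d d∉)))
    where
    residue : ∀ d → ∈02 (d % 5) ≡ false → ∀ e → d ≡ 2 ℕ.* e → Residue≥2 e
    residue _ 2e∉ e refl = excluded 0 refl , excluded 1 refl
      where
      excluded : ∀ r → ∈02 ((2 ℕ.* r) % 5) ≡ true → e % 5 ≢ r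
      excluded r 2r∈ e≡r = true≢false (trans (sym 2r∈)
        (trans (cong ∈02 (sym (trans (%-distribˡ-* 2 e 5) (cong (λ x → (2 ℕ.* x) % 5) e≡r)))) 2e∉))

  factors⊛euler₅₁₀≋euler₂⁹ : ∀ N → prodTo N factor ⊛ (euler 5 N ⊛ euler 10 N) ≋⟨ suc N ⟩ euler₂³ N ⊛ (euler₂³ N ⊛ euler₂³ N)
  factors⊛euler₅₁₀≋euler₂⁹ N = ≋-trans (≋-⊛ (≋-refl {f = a}) (≋-⊛ (≋-sym (euler₁-frobenius N)) (≋-sym (euler₂-frobenius N))))
    (≈⇒≋ (begin
      a ⊛ (euler₁ N ^ₛ 5 ⊛ e ^ₛ 5)
    ≈⟨ ≈-sym (⊛-assoc a (euler₁ N ^ₛ 5) (e ^ₛ 5)) ⟩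
      (a ⊛ euler₁ N ^ₛ 5) ⊛ e ^ₛ 5
    ≈⟨ ⊛-congʳ (e ^ₛ 5) (prodTo-factor N) ⟩
      e ^ₛ 4 ⊛ e ^ₛ 5
    ≈⟨ ⊛-cong (^ₛ-4 e) (^ₛ-5 e) ⟩
      (e ⊛ (e ⊛ (e ⊛ e))) ⊛ (e ⊛ (e ⊛ (e ⊛ (e ⊛ e))))
    ≈⟨ solve 1 (λ e → (e :* (e :* (e :* e))) :* (e :* (e :* (e :* (e :* e)))) := (e :* (e :* e)) :* ((e :* (e :* e)) :* (e :* (e :* e))))
             ≈-refl e ⟩
      euler₂³ N ⊛ (euler₂³ N ⊛ euler₂³ N) ∎))
    where
    open ≈-Reasoning
    a = prodTo N factor
    e = euler 2 N

  a₅-supported : ∀ N → Supported (suc N) (≢ 3) (prodTo N factor)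
  a₅-supported N = Supported-cancel 3
    (Supported-⊛ (euler-supported 5 N refl) (euler-supported 10 N refl) ≡0⊕≡0⊆≡0)
    (cong₂ _*_ (euler-zero 5 N) (euler-zero 10 N))
    (Supported-≋ (factors⊛euler₅₁₀≋euler₂⁹ N)
      (Supported-⊛ (euler₂³-supported N) (Supported-⊛ {S₃ = ∈024} (euler₂³-supported N) (euler₂³-supported N) ∈02⊕∈02⊆∈024) ∈02⊕∈024⊆≢3))

open import Data.Nat using (ℕ; _+_; _*_)
open import Data.Integer using (+_)
open import Data.Integer.Divisibility using (_∣_)
open import Data.Nat using (_%_)
import Data.Nat.Properties as ℕP
open import Data.Nat.DivMod using ([m+kn]%n≡m%n)
open import Data.Integer.Divisibility.Signed using (∣⇒∣ᵤ)
open import Relation.Binary.PropositionalEquality using (_≡_; cong; trans)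
open ResidueSupport using (≢_; vanishes)

theorem1p5 : ∀ (n : ℕ) → + 5 ∣ a₅ (5 * n + 3)
theorem1p5 n = ∣⇒∣ᵤ (vanishes (GeneratingFunction.a₅-supported N) N ℕP.≤-refl (cong (≢ 3) N%5≡3))
  where
  N = 5 * n + 3
  N%5≡3 : N % 5 ≡ 3
  N%5≡3 = trans (cong (_% 5) (trans (ℕP.+-comm (5 * n) 3) (cong (λ m → 3 + m) (ℕP.*-comm 5 n)))) ([m+kn]%n≡m%n 3 n 5)
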